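{- Let $\Gamma$ be an environment, $A$ a System F type and $M$ a good metaterm of $\lambda^{\mathsf F}_{\mathfrak m}$ such that $\mathrm{ver}_A(M^{\Gamma}) \twoheadrightarrow \star$. Then the $\beta$-normal form $M^{\downarrow}$ of $M$ is a System F term such that $\Gamma\vdash M^{\downarrow}:A$.
   Context: There are disjoint denumerable sets of type-variables $a,b,\dots$ and eigenvariables $\mathbf{a},\mathbf{b},\dots$. Types: $A,B ::= a \mid \mathbf{a} \mid A\Rightarrow B \mid \forall a.A$ (eigenvariables are never bound in types or terms). Terms: $t ::= x \mid \lambda x.t \mid t\,s \mid \Lambda a.t \mid t\,A$. Environments are finite sets of assignments $x:A$ to distinct variables. Typing: $\Gamma,x:A\vdash x:A$; from $\Gamma,x:A\vdash t:B$ infer $\Gamma\vdash\lambda x.t:A\Rightarrow B$; from $\Gamma\vdash t:A\Rightarrow B$ and $\Gamma\vdash s:A$ infer $\Gamma\vdash t\,s:B$; from $\Gamma\vdash t:A$ with $a$ not free in $\Gamma$ infer $\Gamma\vdash\Lambda a.t:\forall a.A$; from $\Gamma\vdash t:\forall a.A$ infer $\Gamma\vdash t\,B:A\{a:=B\}$. $\beta$-reduction on terms: $(\lambda x.t)s\to_\beta t\{x:=s\}$, $(\Lambda a.t)A\to_\beta t\{a:=A\}$, closed under contexts. Metaterms of $\lambda^{\mathsf F}_{\mathfrak m}$: $M,N ::= x \mid \lambda x.M \mid M\,N \mid \Lambda a.M \mid M\,A \mid \star \mid (M\triangleright N) \mid \mathrm{gen}_A \mid \mathrm{ver}_A(M)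 \mid \nu\mathbf{a}.M$. A metaterm is pure if built only from the first five productions (pure metaterms are identified with terms, and on them reduction coincides with $\beta$-reduction); good if pure and $\beta$-normalizing. Reduction $\to$ is the closure under arbitrary contexts of: (1) $(\lambda x.M)N\to M\{x:=N\}$; (2) $(\Lambda a.M)A\to M\{a:=A\}$; (3) $(\star\triangleright M)\to M$; (4) $\mathrm{ver}_{\mathbf{a}}(\mathrm{gen}_{\mathbf{a}})\to\star$ for eigenvariables $\mathbf{a}$; (5) $\mathrm{gen}_{A\Rightarrow B}\to\lambda x.(\mathrm{ver}_A(x)\triangleright\mathrm{gen}_B)$; (6) $\mathrm{ver}_{A\Rightarrow B}(M)\to\mathrm{ver}_B(M\,\mathrm{gen}_A)$; (7) $\mathrm{gen}_{\forall a.A}\to\Lambda a.\mathrm{gen}_A$; (8) $\mathrm{ver}_{\forall a.A}(M)\to\nu\mathbf{a}.\mathrm{ver}_{A\{a:=\mathbf{a}\}}(M\,\mathbf{a})$ with $\mathbf{a}$ fresh; (9) $\nu\mathbf{a}.M\to M$ if $\mathbf{a}$ not free in $M$. $\twoheadrightarrow$ is its reflexive-transitive closure. $M^{\Gamma}$ replaces each free occurrence of each $x$ with $x:A\in\Gamma$ by $\mathrm{gen}_A$. -}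

module Defs where

-- Type variables are bound by ∀ / Λ, term variables by λ,
-- eigenvariables are never bound in types or pure terms; they are bound only by ν.

open import Data.Nat using (ℕ; zero; suc)
open import Data.List using (List; []; _∷_; map)
open import Data.Maybe using (Maybe; just; nothing; maybe)
open import Data.Product using (Σ; _×_; _,_; ∃)
open import Relation.Binary.PropositionalEquality using (_≡_)
open import Relation.Binary.Construct.Closure.ReflexiveTransitive using (Star)
open import Relation.Nullary using (¬_)

infixr 7 _⇒_

data Ty : Set where
  tv   : ℕ → Ty
  ev   : ℕ → Ty
  _⇒_  : Ty → Ty → Ty
  ∀'   : Ty → Ty

liftR : (ℕ → ℕ) → ℕ → ℕ
liftR ρ zero    = zero
liftR ρ (suc n) = suc (ρ n)

renT : (ℕ → ℕ) → Ty → Ty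
renT ρ (tv n)   = tv (ρ n)
renT ρ (ev n)   = ev n
renT ρ (A ⇒ B)  = renT ρ A ⇒ renT ρ B
renT ρ (∀' A)   = ∀' (renT (liftR ρ) A)

renE : (ℕ → ℕ) → Ty → Ty
renE ρ (tv n)   = tv n
renE ρ (ev n)   = ev (ρ n)
renE ρ (A ⇒ B)  = renE ρ A ⇒ renE ρ B
renE ρ (∀' A)   = ∀' (renE ρ A)

extsT : (ℕ → Ty) → ℕ → Ty
extsT σ zero    = tv zero
extsT σ (suc n) = renT suc (σ n)

substT : (ℕ → Ty) → Ty → Ty
substT σ (tv n)  = σ n
substT σ (ev n)  = ev n
substT σ (A ⇒ B) = substT σ A ⇒ substT σ B
substT σ (∀' A)  = ∀' (substT (extsT σ) A)

_[_]T : Ty → Ty → Ty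
A [ B ]T = substT σ A
  where
  σ : ℕ → Ty
  σ zero    = B
  σ (suc n) = tv n

infixl 6 _·_ _·T_
infix 5 _▷_

data Tm : Set where
  var  : ℕ → Tm
  ƛ    : Tm → Tm
  _·_  : Tm → Tm → Tm
  Λ    : Tm → Tm
  _·T_ : Tm → Ty → Tm
  ⋆    : Tm
  _▷_  : Tm → Tm → Tm
  gen  : Ty → Tm
  ver  : Ty → Tm → Tm
  ν    : Tm → Tm

renV : (ℕ → ℕ) → Tm → Tm
renV ρ (var n)   = var (ρ n)
renV ρ (ƛ M)     = ƛ (renV (liftR ρ) M)
renV ρ (M · N)   = renV ρ M · renV ρ N
renV ρ (Λ M)     = Λ (renV ρ M)
renV ρ (M ·T A)  = renV ρ M ·T A
renV ρ ⋆         = ⋆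
renV ρ (M ▷ N)   = renV ρ M ▷ renV ρ N
renV ρ (gen A)   = gen A
renV ρ (ver A M) = ver A (renV ρ M)
renV ρ (ν M)     = ν (renV ρ M)

renTM : (ℕ → ℕ) → Tm → Tm
renTM ρ (var n)   = var n
renTM ρ (ƛ M)     = ƛ (renTM ρ M)
renTM ρ (M · N)   = renTM ρ M · renTM ρ N
renTM ρ (Λ M)     = Λ (renTM (liftR ρ) M)
renTM ρ (M ·T A)  = renTM ρ M ·T renT ρ A
renTM ρ ⋆         = ⋆
renTM ρ (M ▷ N)   = renTM ρ M ▷ renTM ρ N
renTM ρ (gen A)   = gen (renT ρ A)
renTM ρ (ver A M) = ver (renT ρ A) (renTM ρ M)
renTM ρ (ν M)     = ν (renTM ρ M)

renEM : (ℕ → ℕ) → Tm → Tm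
renEM ρ (var n)   = var n
renEM ρ (ƛ M)     = ƛ (renEM ρ M)
renEM ρ (M · N)   = renEM ρ M · renEM ρ N
renEM ρ (Λ M)     = Λ (renEM ρ M)
renEM ρ (M ·T A)  = renEM ρ M ·T renE ρ A
renEM ρ ⋆         = ⋆
renEM ρ (M ▷ N)   = renEM ρ M ▷ renEM ρ N
renEM ρ (gen A)   = gen (renE ρ A)
renEM ρ (ver A M) = ver (renE ρ A) (renEM ρ M)
renEM ρ (ν M)     = ν (renEM (liftR ρ) M)

extsV : (ℕ → Tm) → ℕ → Tm
extsV σ zero    = var zero
extsV σ (suc n) = renV suc (σ n)

substV : (ℕ → Tm) → Tm → Tm
substV σ (var n)   = σ n
substV σ (ƛ M)     = ƛ (substV (extsV σ) M)
substV σ (M · N)   = substV σ M · substV σ N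
substV σ (Λ M)     = Λ (substV (λ n → renTM suc (σ n)) M)
substV σ (M ·T A)  = substV σ M ·T A
substV σ ⋆         = ⋆
substV σ (M ▷ N)   = substV σ M ▷ substV σ N
substV σ (gen A)   = gen A
substV σ (ver A M) = ver A (substV σ M)
substV σ (ν M)     = ν (substV (λ n → renEM suc (σ n)) M)

substTM : (ℕ → Ty) → Tm → Tm
substTM σ (var n)   = var n
substTM σ (ƛ M)     = ƛ (substTM σ M)
substTM σ (M · N)   = substTM σ M · substTM σ N
substTM σ (Λ M)     = Λ (substTM (extsT σ) M)
substTM σ (M ·T A)  = substTM σ M ·T substT σ A
substTM σ ⋆         = ⋆
substTM σ (M ▷ N)   = substTM σ M ▷ substTM σ N
substTM σ (gen A)   = gen (substT σ A)
substTM σ (ver A M) = ver (substT σ A) (substTM σ M)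
substTM σ (ν M)     = ν (substTM (λ n → renE suc (σ n)) M)

_[_]V : Tm → Tm → Tm
M [ N ]V = substV σ M
  where
  σ : ℕ → Tm
  σ zero    = N
  σ (suc n) = var n

_[_]TM : Tm → Ty → Tm
M [ A ]TM = substTM σ M
  where
  σ : ℕ → Ty
  σ zero    = A
  σ (suc n) = tv n

-- A{a := 𝐚} where 𝐚 is the eigenvariable freshly bound by an enclosing ν:
-- A lives under ∀, is moved under ν (eigenvariables shifted) and tv 0 := ev 0.
openEv : Ty → Ty
openEv A = renE suc A [ ev zero ]T

infix 4 _⟶_ _↠_

data _⟶_ : Tm → Tm → Set where
  β-ƛ   : ∀ {M N} → (ƛ M) · N ⟶ M [ N ]V
  β-Λ   : ∀ {M A} → (Λ M) ·T A ⟶ M [ A ]TM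
  r-▷   : ∀ {M} → (⋆ ▷ M) ⟶ M
  r-ver-ev : ∀ {n} → ver (ev n) (gen (ev n)) ⟶ ⋆
  r-gen-⇒  : ∀ {A B} → gen (A ⇒ B) ⟶ ƛ (ver A (var zero) ▷ gen B)
  r-ver-⇒  : ∀ {A B M} → ver (A ⇒ B) M ⟶ ver B (M · gen A)
  r-gen-∀  : ∀ {A} → gen (∀' A) ⟶ Λ (gen A)
  r-ver-∀  : ∀ {A M} → ver (∀' A) M ⟶ ν (ver (openEv A) (renEM suc M ·T ev zero))
  -- (9)  ν𝐚.M → M when 𝐚 (= ev 0) is not free in M, i.e. M is a shifted M'
  r-ν      : ∀ {M} → ν (renEM suc M) ⟶ M
  ξ-ƛ   : ∀ {M M'} → M ⟶ M' → ƛ M ⟶ ƛ M'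
  ξ-·₁  : ∀ {M M' N} → M ⟶ M' → M · N ⟶ M' · N
  ξ-·₂  : ∀ {M N N'} → N ⟶ N' → M · N ⟶ M · N'
  ξ-Λ   : ∀ {M M'} → M ⟶ M' → Λ M ⟶ Λ M'
  ξ-·T  : ∀ {M M' A} → M ⟶ M' → M ·T A ⟶ M' ·T A
  ξ-▷₁  : ∀ {M M' N} → M ⟶ M' → (M ▷ N) ⟶ (M' ▷ N)
  ξ-▷₂  : ∀ {M N N'} → N ⟶ N' → (M ▷ N) ⟶ (M ▷ N')
  ξ-ver : ∀ {A M M'} → M ⟶ M' → ver A M ⟶ ver A M'
  ξ-ν   : ∀ {M M'} → M ⟶ M' → ν M ⟶ ν M'

_↠_ : Tm → Tm → Set
_↠_ = Star _⟶_

-- Pure metaterms (= System F terms) and β-reduction on them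

data Pure : Tm → Set where
  p-var : ∀ {n} → Pure (var n)
  p-ƛ   : ∀ {M} → Pure M → Pure (ƛ M)
  p-·   : ∀ {M N} → Pure M → Pure N → Pure (M · N)
  p-Λ   : ∀ {M} → Pure M → Pure (Λ M)
  p-·T  : ∀ {M A} → Pure M → Pure (M ·T A)

infix 4 _⟶β_ _↠β_

data _⟶β_ : Tm → Tm → Set where
  β-ƛ   : ∀ {M N} → (ƛ M) · N ⟶β M [ N ]V
  β-Λ   : ∀ {M A} → (Λ M) ·T A ⟶β M [ A ]TM
  ξ-ƛ   : ∀ {M M'} → M ⟶β M' → ƛ M ⟶β ƛ M'
  ξ-·₁  : ∀ {M M' N} → M ⟶β M' → M · N ⟶β M' · N
  ξ-·₂  : ∀ {M N N'} → N ⟶β N' → M · N ⟶β M · N'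
  ξ-Λ   : ∀ {M M'} → M ⟶β M' → Λ M ⟶β Λ M'
  ξ-·T  : ∀ {M M' A} → M ⟶β M' → M ·T A ⟶β M' ·T A

_↠β_ : Tm → Tm → Set
_↠β_ = Star _⟶β_

β-Normal : Tm → Set
β-Normal M = ∀ {M'} → ¬ (M ⟶β M')

Good : Tm → Set
Good M = Pure M × ∃ λ N → (M ↠β N) × β-Normal N

Env : Set
Env = List Ty

lookupEnv : Env → ℕ → Maybe Ty
lookupEnv []      n       = nothing
lookupEnv (A ∷ Γ) zero    = just A
lookupEnv (A ∷ Γ) (suc n) = lookupEnv Γ n

infix 4 _⊢_∶_

data _⊢_∶_ : Env → Tm → Ty → Set where
  ⊢var : ∀ {Γ n A} → lookupEnv Γ n ≡ just A → Γ ⊢ var n ∶ A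
  ⊢ƛ   : ∀ {Γ M A B} → (A ∷ Γ) ⊢ M ∶ B → Γ ⊢ ƛ M ∶ A ⇒ B
  ⊢·   : ∀ {Γ M N A B} → Γ ⊢ M ∶ A ⇒ B → Γ ⊢ N ∶ A → Γ ⊢ M · N ∶ B
  -- "a not free in Γ": in de Bruijn form, Γ is shifted past the new binder
  ⊢Λ   : ∀ {Γ M A} → map (renT suc) Γ ⊢ M ∶ A → Γ ⊢ Λ M ∶ ∀' A
  ⊢·T  : ∀ {Γ M A} B → Γ ⊢ M ∶ ∀' A → Γ ⊢ M ·T B ∶ A [ B ]T

_^_ : Tm → Env → Tm
M ^ Γ = substV σ M
  where
  σ : ℕ → Tm
  σ n = maybe gen (var n) (lookupEnv Γ n)

-- Since λF_m is confluent and ⋆ is normal, ver_A(M^Γ) ↠ ⋆ carries over to the β-normal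
-- form N.  A derivation Γ ⊢ N : A is then read off N bidirectionally.  An abstraction
-- is only accepted at a matching type: ver_{B⇒C}(λx.N′) reduces to ver_C(N′{x:=gen_B}), and
-- ver_{∀a.C}(Λa.N′) to ν𝐚.ver_{C{a:=𝐚}}(N′{a:=𝐚}), the eigenvariable being abstracted back into a
-- type variable afterwards.  A neutral term x e₁ … eₙ needs x : C ∈ Γ; then gen_C unfolds along
-- the eliminations, each argument N_i has to pass the check ver_{C_i}(N_i) ↠ ⋆ that appears at the
-- head of the spine, and finally ver_A(gen_{C′}) ↠ ⋆ forces A = C′.  Every other shape leaves a
-- rigid head, from which ⋆ is unreachable.

module Submission where

open import Defs
open import Data.Empty using (⊥-elim)
open import Data.List using (List; []; _∷_; map)
open import Data.List.Properties using (map-∘; map-cong)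
open import Data.Maybe using (Maybe; just; nothing; maybe)
import Data.Maybe as Maybe
open import Data.Nat using (ℕ; zero; suc; pred; _+_; _≤_; s≤s)
open import Data.Nat.Properties
  using (suc-injective; ≤-refl; ≤-trans; m≤m+n; m≤n+m; m+n≤o⇒m≤o; m+n≤o⇒n≤o)
open import Data.Product using (Σ; _×_; _,_)
open import Data.Sum using (_⊎_; inj₁; inj₂; map₁)
open import Function using (_∘_; id)
open import Function.Definitions using (Injective)
open import Relation.Binary.Construct.Closure.ReflexiveTransitive
  using (Star; ε; _◅_; _◅◅_; gmap; return; kleisliStar)
open import Relation.Binary.PropositionalEquality
  using (_≡_; refl; sym; trans; cong; cong₂; subst; subst₂; _≗_; module ≡-Reasoning)
open import Relation.Nullary using (¬_)

private variable
  k m n : ℕ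
  ρ f g f′ g′ : ℕ → ℕ
  σ φ : ℕ → Tm
  Γ Δ : Env
  A A′ B B′ C D T : Ty
  M M′ N N′ N₁ N₂ P Q X X′ Y : Tm

≗-refl : ∀ {S S′ : Set} {f : S → S′} → f ≗ f
≗-refl _ = refl

extsE : (ℕ → Ty) → ℕ → Ty
extsE e zero    = ev zero
extsE e (suc n) = renE suc (e n)

-- Every renaming and substitution of Defs is an instance of subTy or subTm, which act at once on
-- type variables (t) and eigenvariables (e), and on term variables (v).
subTy : (ℕ → Ty) → (ℕ → Ty) → Ty → Ty
subTy t e (tv n)  = t n
subTy t e (ev n)  = e n
subTy t e (A ⇒ B) = subTy t e A ⇒ subTy t e B
subTy t e (∀' A)  = ∀' (subTy (extsT t) (renT suc ∘ e) A)

extsT-cong : ∀ {t t′} → t ≗ t′ → extsT t ≗ extsT t′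
extsT-cong t≗t′ zero    = refl
extsT-cong t≗t′ (suc n) = cong (renT suc) (t≗t′ n)

extsE-cong : ∀ {e e′} → e ≗ e′ → extsE e ≗ extsE e′
extsE-cong e≗e′ zero    = refl
extsE-cong e≗e′ (suc n) = cong (renE suc) (e≗e′ n)

extsT-tv : extsT tv ≗ tv
extsT-tv zero    = refl
extsT-tv (suc n) = refl

extsE-ev : extsE ev ≗ ev
extsE-ev zero    = refl
extsE-ev (suc n) = refl

extsT-liftR : ∀ t ρ → extsT t ∘ liftR ρ ≗ extsT (t ∘ ρ)
extsT-liftR t ρ zero    = refl
extsT-liftR t ρ (suc n) = refl

extsE-liftR : ∀ e ρ → extsE e ∘ liftR ρ ≗ extsE (e ∘ ρ)
extsE-liftR e ρ zero    = refl
extsE-liftR e ρ (suc n) = refl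

extsT-renaming : ∀ {t ρ} → t ≗ tv ∘ ρ → extsT t ≗ tv ∘ liftR ρ
extsT-renaming t≗ zero    = refl
extsT-renaming t≗ (suc n) = cong (renT suc) (t≗ n)

extsE-renaming : ∀ {e ρ} → e ≗ ev ∘ ρ → extsE e ≗ ev ∘ liftR ρ
extsE-renaming e≗ zero    = refl
extsE-renaming e≗ (suc n) = cong (renE suc) (e≗ n)

subTy-cong : ∀ {t t′ e e′} → t ≗ t′ → e ≗ e′ → subTy t e ≗ subTy t′ e′
subTy-cong t≗ e≗ (tv n)  = t≗ n
subTy-cong t≗ e≗ (ev n)  = e≗ n
subTy-cong t≗ e≗ (A ⇒ B) = cong₂ _⇒_ (subTy-cong t≗ e≗ A) (subTy-cong t≗ e≗ B)
subTy-cong t≗ e≗ (∀' A)  = cong ∀' (subTy-cong (extsT-cong t≗) (cong (renT suc) ∘ e≗) A)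

subTy-identity : ∀ A → subTy tv ev A ≡ A
subTy-identity (tv n)  = refl
subTy-identity (ev n)  = refl
subTy-identity (A ⇒ B) = cong₂ _⇒_ (subTy-identity A) (subTy-identity B)
subTy-identity (∀' A)  = cong ∀' (trans (subTy-cong extsT-tv ≗-refl A) (subTy-identity A))

subTy-id : ∀ {t e} → t ≗ tv → e ≗ ev → ∀ A → subTy t e A ≡ A
subTy-id t≗ e≗ A = trans (subTy-cong t≗ e≗ A) (subTy-identity A)

renT-subTy : ∀ ρ A → renT ρ A ≡ subTy (tv ∘ ρ) ev A
renT-subTy ρ (tv n)  = refl
renT-subTy ρ (ev n)  = refl
renT-subTy ρ (A ⇒ B) = cong₂ _⇒_ (renT-subTy ρ A) (renT-subTy ρ B)
renT-subTy ρ (∀' A)  =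
  cong ∀' (trans (renT-subTy (liftR ρ) A) (subTy-cong (sym ∘ extsT-renaming ≗-refl) ≗-refl A))

renE-subTy : ∀ ρ A → renE ρ A ≡ subTy tv (ev ∘ ρ) A
renE-subTy ρ (tv n)  = refl
renE-subTy ρ (ev n)  = refl
renE-subTy ρ (A ⇒ B) = cong₂ _⇒_ (renE-subTy ρ A) (renE-subTy ρ B)
renE-subTy ρ (∀' A)  =
  cong ∀' (trans (renE-subTy ρ A) (subTy-cong (sym ∘ extsT-tv) ≗-refl A))

substT-subTy : ∀ σ A → substT σ A ≡ subTy σ ev A
substT-subTy σ (tv n)  = refl
substT-subTy σ (ev n)  = refl
substT-subTy σ (A ⇒ B) = cong₂ _⇒_ (substT-subTy σ A) (substT-subTy σ B)
substT-subTy σ (∀' A)  = cong ∀' (substT-subTy (extsT σ) A)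

subTy-renaming : ∀ {t₀ e₀} ρ π → t₀ ≗ tv ∘ ρ → e₀ ≗ ev ∘ π → ∀ t e A →
                 subTy t e (subTy t₀ e₀ A) ≡ subTy (t ∘ ρ) (e ∘ π) A
subTy-renaming ρ π t₀≗ e₀≗ t e (tv n)  = cong (subTy t e) (t₀≗ n)
subTy-renaming ρ π t₀≗ e₀≗ t e (ev n)  = cong (subTy t e) (e₀≗ n)
subTy-renaming ρ π t₀≗ e₀≗ t e (A ⇒ B) =
  cong₂ _⇒_ (subTy-renaming ρ π t₀≗ e₀≗ t e A) (subTy-renaming ρ π t₀≗ e₀≗ t e B)
subTy-renaming ρ π t₀≗ e₀≗ t e (∀' A)  = cong ∀' (trans
  (subTy-renaming (liftR ρ) π (extsT-renaming t₀≗) (cong (renT suc) ∘ e₀≗)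
                  (extsT t) (renT suc ∘ e) A)
  (subTy-cong (extsT-liftR t ρ) ≗-refl A))

subTy-weakenT-renaming : ∀ {t₀ e₀} ρ π → t₀ ≗ tv ∘ ρ → e₀ ≗ ev ∘ π → ∀ A →
  subTy (extsT t₀) (renT suc ∘ e₀) (renT suc A) ≡ renT suc (subTy t₀ e₀ A)
subTy-weakenT-renaming ρ π t₀≗ e₀≗ A = begin
  subTy (extsT _) (renT suc ∘ _) (renT suc A)
    ≡⟨ cong (subTy _ _) (renT-subTy suc A) ⟩
  subTy (extsT _) (renT suc ∘ _) (subTy (tv ∘ suc) ev A)
    ≡⟨ subTy-renaming suc id ≗-refl ≗-refl _ _ A ⟩
  subTy (renT suc ∘ _) (renT suc ∘ _) A
    ≡⟨ subTy-cong (cong (renT suc) ∘ t₀≗) (cong (renT suc) ∘ e₀≗) A ⟩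
  subTy (tv ∘ suc ∘ ρ) (ev ∘ π) A
    ≡⟨ sym (subTy-renaming ρ π t₀≗ e₀≗ (tv ∘ suc) ev A) ⟩
  subTy (tv ∘ suc) ev (subTy _ _ A)
    ≡⟨ sym (renT-subTy suc _) ⟩
  renT suc (subTy _ _ A) ∎
  where open ≡-Reasoning

renaming-subTy : ∀ {t₀ e₀} ρ π → t₀ ≗ tv ∘ ρ → e₀ ≗ ev ∘ π → ∀ t e A →
                 subTy t₀ e₀ (subTy t e A) ≡ subTy (subTy t₀ e₀ ∘ t) (subTy t₀ e₀ ∘ e) A
renaming-subTy ρ π t₀≗ e₀≗ t e (tv n)  = refl
renaming-subTy ρ π t₀≗ e₀≗ t e (ev n)  = refl
renaming-subTy ρ π t₀≗ e₀≗ t e (A ⇒ B) =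
  cong₂ _⇒_ (renaming-subTy ρ π t₀≗ e₀≗ t e A) (renaming-subTy ρ π t₀≗ e₀≗ t e B)
renaming-subTy {t₀} {e₀} ρ π t₀≗ e₀≗ t e (∀' A) = cong ∀' (trans
  (renaming-subTy (liftR ρ) π (extsT-renaming t₀≗) (cong (renT suc) ∘ e₀≗)
                  (extsT t) (renT suc ∘ e) A)
  (subTy-cong lifted (weaken ∘ e) A))
  where
  weaken : ∀ B → subTy (extsT t₀) (renT suc ∘ e₀) (renT suc B) ≡ renT suc (subTy t₀ e₀ B)
  weaken = subTy-weakenT-renaming ρ π t₀≗ e₀≗
  lifted : subTy (extsT t₀) (renT suc ∘ e₀) ∘ extsT t ≗ extsT (subTy t₀ e₀ ∘ t)
  lifted zero    = refl
  lifted (suc n) = weaken (t n)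

subTy-weakenT : ∀ t e A → subTy (extsT t) (renT suc ∘ e) (renT suc A) ≡ renT suc (subTy t e A)
subTy-weakenT t e A = begin
  subTy (extsT t) (renT suc ∘ e) (renT suc A)
    ≡⟨ cong (subTy _ _) (renT-subTy suc A) ⟩
  subTy (extsT t) (renT suc ∘ e) (subTy (tv ∘ suc) ev A)
    ≡⟨ subTy-renaming suc id ≗-refl ≗-refl _ _ A ⟩
  subTy (renT suc ∘ t) (renT suc ∘ e) A
    ≡⟨ subTy-cong (renT-subTy suc ∘ t) (renT-subTy suc ∘ e) A ⟩
  subTy (subTy (tv ∘ suc) ev ∘ t) (subTy (tv ∘ suc) ev ∘ e) A
    ≡⟨ sym (renaming-subTy suc id ≗-refl ≗-refl t e A) ⟩
  subTy (tv ∘ suc) ev (subTy t e A)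
    ≡⟨ sym (renT-subTy suc _) ⟩
  renT suc (subTy t e A) ∎
  where open ≡-Reasoning

subTy-weakenE : ∀ t e A → subTy (renE suc ∘ t) (extsE e) (renE suc A) ≡ renE suc (subTy t e A)
subTy-weakenE t e A = begin
  subTy (renE suc ∘ t) (extsE e) (renE suc A)
    ≡⟨ cong (subTy _ _) (renE-subTy suc A) ⟩
  subTy (renE suc ∘ t) (extsE e) (subTy tv (ev ∘ suc) A)
    ≡⟨ subTy-renaming id suc ≗-refl ≗-refl _ _ A ⟩
  subTy (renE suc ∘ t) (renE suc ∘ e) A
    ≡⟨ subTy-cong (renE-subTy suc ∘ t) (renE-subTy suc ∘ e) A ⟩
  subTy (subTy tv (ev ∘ suc) ∘ t) (subTy tv (ev ∘ suc) ∘ e) A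
    ≡⟨ sym (renaming-subTy id suc ≗-refl ≗-refl t e A) ⟩
  subTy tv (ev ∘ suc) (subTy t e A)
    ≡⟨ sym (renE-subTy suc _) ⟩
  renE suc (subTy t e A) ∎
  where open ≡-Reasoning

subTy-subTy : ∀ t′ e′ t e A →
              subTy t′ e′ (subTy t e A) ≡ subTy (subTy t′ e′ ∘ t) (subTy t′ e′ ∘ e) A
subTy-subTy t′ e′ t e (tv n)  = refl
subTy-subTy t′ e′ t e (ev n)  = refl
subTy-subTy t′ e′ t e (A ⇒ B) = cong₂ _⇒_ (subTy-subTy t′ e′ t e A) (subTy-subTy t′ e′ t e B)
subTy-subTy t′ e′ t e (∀' A)  = cong ∀' (trans
  (subTy-subTy (extsT t′) (renT suc ∘ e′) (extsT t) (renT suc ∘ e) A)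
  (subTy-cong lifted (subTy-weakenT t′ e′ ∘ e) A))
  where
  lifted : subTy (extsT t′) (renT suc ∘ e′) ∘ extsT t ≗ extsT (subTy t′ e′ ∘ t)
  lifted zero    = refl
  lifted (suc n) = subTy-weakenT t′ e′ (t n)

subTm : (ℕ → Tm) → (ℕ → Ty) → (ℕ → Ty) → Tm → Tm
subTm v t e (var n)   = v n
subTm v t e (ƛ M)     = ƛ (subTm (extsV v) t e M)
subTm v t e (M · N)   = subTm v t e M · subTm v t e N
subTm v t e (Λ M)     = Λ (subTm (renTM suc ∘ v) (extsT t) (renT suc ∘ e) M)
subTm v t e (M ·T A)  = subTm v t e M ·T subTy t e A
subTm v t e ⋆         = ⋆
subTm v t e (M ▷ N)   = subTm v t e M ▷ subTm v t e N
subTm v t e (gen A)   = gen (subTy t e A)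
subTm v t e (ver A M) = ver (subTy t e A) (subTm v t e M)
subTm v t e (ν M)     = ν (subTm (renEM suc ∘ v) (renE suc ∘ t) (extsE e) M)

extsV-cong : ∀ {v v′} → v ≗ v′ → extsV v ≗ extsV v′
extsV-cong v≗v′ zero    = refl
extsV-cong v≗v′ (suc n) = cong (renV suc) (v≗v′ n)

extsV-var : extsV var ≗ var
extsV-var zero    = refl
extsV-var (suc n) = refl

extsV-liftR : ∀ v ρ → extsV v ∘ liftR ρ ≗ extsV (v ∘ ρ)
extsV-liftR v ρ zero    = refl
extsV-liftR v ρ (suc n) = refl

extsV-renaming : ∀ {v ρ} → v ≗ var ∘ ρ → extsV v ≗ var ∘ liftR ρ
extsV-renaming v≗ zero    = refl
extsV-renaming v≗ (suc n) = cong (renV suc) (v≗ n)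

subTm-cong : ∀ {v v′ t t′ e e′} → v ≗ v′ → t ≗ t′ → e ≗ e′ →
             subTm v t e ≗ subTm v′ t′ e′
subTm-cong v≗ t≗ e≗ (var n)   = v≗ n
subTm-cong v≗ t≗ e≗ (ƛ M)     = cong ƛ (subTm-cong (extsV-cong v≗) t≗ e≗ M)
subTm-cong v≗ t≗ e≗ (M · N)   = cong₂ _·_ (subTm-cong v≗ t≗ e≗ M) (subTm-cong v≗ t≗ e≗ N)
subTm-cong v≗ t≗ e≗ (Λ M)     =
  cong Λ (subTm-cong (cong (renTM suc) ∘ v≗) (extsT-cong t≗) (cong (renT suc) ∘ e≗) M)
subTm-cong v≗ t≗ e≗ (M ·T A)  = cong₂ _·T_ (subTm-cong v≗ t≗ e≗ M) (subTy-cong t≗ e≗ A)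
subTm-cong v≗ t≗ e≗ ⋆         = refl
subTm-cong v≗ t≗ e≗ (M ▷ N)   = cong₂ _▷_ (subTm-cong v≗ t≗ e≗ M) (subTm-cong v≗ t≗ e≗ N)
subTm-cong v≗ t≗ e≗ (gen A)   = cong gen (subTy-cong t≗ e≗ A)
subTm-cong v≗ t≗ e≗ (ver A M) = cong₂ ver (subTy-cong t≗ e≗ A) (subTm-cong v≗ t≗ e≗ M)
subTm-cong v≗ t≗ e≗ (ν M)     =
  cong ν (subTm-cong (cong (renEM suc) ∘ v≗) (cong (renE suc) ∘ t≗) (extsE-cong e≗) M)

subTm-identity : ∀ M → subTm var tv ev M ≡ M
subTm-identity (var n)   = refl
subTm-identity (ƛ M)     = cong ƛ (trans (subTm-cong extsV-var ≗-refl ≗-refl M) (subTm-identity M))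
subTm-identity (M · N)   = cong₂ _·_ (subTm-identity M) (subTm-identity N)
subTm-identity (Λ M)     = cong Λ (trans (subTm-cong ≗-refl extsT-tv ≗-refl M) (subTm-identity M))
subTm-identity (M ·T A)  = cong₂ _·T_ (subTm-identity M) (subTy-identity A)
subTm-identity ⋆         = refl
subTm-identity (M ▷ N)   = cong₂ _▷_ (subTm-identity M) (subTm-identity N)
subTm-identity (gen A)   = cong gen (subTy-identity A)
subTm-identity (ver A M) = cong₂ ver (subTy-identity A) (subTm-identity M)
subTm-identity (ν M)     = cong ν (trans (subTm-cong ≗-refl ≗-refl extsE-ev M) (subTm-identity M))

subTm-id : ∀ {v t e} → v ≗ var → t ≗ tv → e ≗ ev → ∀ M → subTm v t e M ≡ M
subTm-id v≗ t≗ e≗ M = trans (subTm-cong v≗ t≗ e≗ M) (subTm-identity M)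

renV-subTm : ∀ ρ M → renV ρ M ≡ subTm (var ∘ ρ) tv ev M
renV-subTm ρ (var n)   = refl
renV-subTm ρ (ƛ M)     = cong ƛ (trans (renV-subTm (liftR ρ) M)
  (subTm-cong (sym ∘ extsV-renaming ≗-refl) ≗-refl ≗-refl M))
renV-subTm ρ (M · N)   = cong₂ _·_ (renV-subTm ρ M) (renV-subTm ρ N)
renV-subTm ρ (Λ M)     = cong Λ (trans (renV-subTm ρ M) (subTm-cong ≗-refl (sym ∘ extsT-tv) ≗-refl M))
renV-subTm ρ (M ·T A)  = cong₂ _·T_ (renV-subTm ρ M) (sym (subTy-identity A))
renV-subTm ρ ⋆         = refl
renV-subTm ρ (M ▷ N)   = cong₂ _▷_ (renV-subTm ρ M) (renV-subTm ρ N)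
renV-subTm ρ (gen A)   = cong gen (sym (subTy-identity A))
renV-subTm ρ (ver A M) = cong₂ ver (sym (subTy-identity A)) (renV-subTm ρ M)
renV-subTm ρ (ν M)     = cong ν (trans (renV-subTm ρ M) (subTm-cong ≗-refl ≗-refl (sym ∘ extsE-ev) M))

renTM-subTm : ∀ ρ M → renTM ρ M ≡ subTm var (tv ∘ ρ) ev M
renTM-subTm ρ (var n)   = refl
renTM-subTm ρ (ƛ M)     = cong ƛ (trans (renTM-subTm ρ M) (subTm-cong (sym ∘ extsV-var) ≗-refl ≗-refl M))
renTM-subTm ρ (M · N)   = cong₂ _·_ (renTM-subTm ρ M) (renTM-subTm ρ N)
renTM-subTm ρ (Λ M)     = cong Λ (trans (renTM-subTm (liftR ρ) M)
  (subTm-cong ≗-refl (sym ∘ extsT-renaming ≗-refl) ≗-refl M))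
renTM-subTm ρ (M ·T A)  = cong₂ _·T_ (renTM-subTm ρ M) (renT-subTy ρ A)
renTM-subTm ρ ⋆         = refl
renTM-subTm ρ (M ▷ N)   = cong₂ _▷_ (renTM-subTm ρ M) (renTM-subTm ρ N)
renTM-subTm ρ (gen A)   = cong gen (renT-subTy ρ A)
renTM-subTm ρ (ver A M) = cong₂ ver (renT-subTy ρ A) (renTM-subTm ρ M)
renTM-subTm ρ (ν M)     = cong ν (trans (renTM-subTm ρ M) (subTm-cong ≗-refl ≗-refl (sym ∘ extsE-ev) M))

renEM-subTm : ∀ ρ M → renEM ρ M ≡ subTm var tv (ev ∘ ρ) M
renEM-subTm ρ (var n)   = refl
renEM-subTm ρ (ƛ M)     = cong ƛ (trans (renEM-subTm ρ M) (subTm-cong (sym ∘ extsV-var) ≗-refl ≗-refl M))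
renEM-subTm ρ (M · N)   = cong₂ _·_ (renEM-subTm ρ M) (renEM-subTm ρ N)
renEM-subTm ρ (Λ M)     = cong Λ (trans (renEM-subTm ρ M) (subTm-cong ≗-refl (sym ∘ extsT-tv) ≗-refl M))
renEM-subTm ρ (M ·T A)  = cong₂ _·T_ (renEM-subTm ρ M) (renE-subTy ρ A)
renEM-subTm ρ ⋆         = refl
renEM-subTm ρ (M ▷ N)   = cong₂ _▷_ (renEM-subTm ρ M) (renEM-subTm ρ N)
renEM-subTm ρ (gen A)   = cong gen (renE-subTy ρ A)
renEM-subTm ρ (ver A M) = cong₂ ver (renE-subTy ρ A) (renEM-subTm ρ M)
renEM-subTm ρ (ν M)     = cong ν (trans (renEM-subTm (liftR ρ) M)
  (subTm-cong ≗-refl ≗-refl (sym ∘ extsE-renaming ≗-refl) M))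

substV-subTm : ∀ σ M → substV σ M ≡ subTm σ tv ev M
substV-subTm σ (var n)   = refl
substV-subTm σ (ƛ M)     = cong ƛ (substV-subTm (extsV σ) M)
substV-subTm σ (M · N)   = cong₂ _·_ (substV-subTm σ M) (substV-subTm σ N)
substV-subTm σ (Λ M)     = cong Λ (trans (substV-subTm _ M) (subTm-cong ≗-refl (sym ∘ extsT-tv) ≗-refl M))
substV-subTm σ (M ·T A)  = cong₂ _·T_ (substV-subTm σ M) (sym (subTy-identity A))
substV-subTm σ ⋆         = refl
substV-subTm σ (M ▷ N)   = cong₂ _▷_ (substV-subTm σ M) (substV-subTm σ N)
substV-subTm σ (gen A)   = cong gen (sym (subTy-identity A))
substV-subTm σ (ver A M) = cong₂ ver (sym (subTy-identity A)) (substV-subTm σ M)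
substV-subTm σ (ν M)     = cong ν (trans (substV-subTm _ M) (subTm-cong ≗-refl ≗-refl (sym ∘ extsE-ev) M))

substTM-subTm : ∀ σ M → substTM σ M ≡ subTm var σ ev M
substTM-subTm σ (var n)   = refl
substTM-subTm σ (ƛ M)     = cong ƛ (trans (substTM-subTm σ M) (subTm-cong (sym ∘ extsV-var) ≗-refl ≗-refl M))
substTM-subTm σ (M · N)   = cong₂ _·_ (substTM-subTm σ M) (substTM-subTm σ N)
substTM-subTm σ (Λ M)     = cong Λ (substTM-subTm (extsT σ) M)
substTM-subTm σ (M ·T A)  = cong₂ _·T_ (substTM-subTm σ M) (substT-subTy σ A)
substTM-subTm σ ⋆         = refl
substTM-subTm σ (M ▷ N)   = cong₂ _▷_ (substTM-subTm σ M) (substTM-subTm σ N)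
substTM-subTm σ (gen A)   = cong gen (substT-subTy σ A)
substTM-subTm σ (ver A M) = cong₂ ver (substT-subTy σ A) (substTM-subTm σ M)
substTM-subTm σ (ν M)     = cong ν (trans (substTM-subTm _ M) (subTm-cong ≗-refl ≗-refl (sym ∘ extsE-ev) M))

record IsRenaming (v : ℕ → Tm) (t e : ℕ → Ty) : Set where
  field
    ρv ρt ρe : ℕ → ℕ
    v≗ : v ≗ var ∘ ρv
    t≗ : t ≗ tv ∘ ρt
    e≗ : e ≗ ev ∘ ρe
open IsRenaming

IsRenaming-ƛ : ∀ {v t e} → IsRenaming v t e → IsRenaming (extsV v) t e
IsRenaming-ƛ R = record
  { ρv = liftR (ρv R) ; ρt = ρt R ; ρe = ρe R
  ; v≗ = extsV-renaming (v≗ R) ; t≗ = t≗ R ; e≗ = e≗ R }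

IsRenaming-Λ : ∀ {v t e} → IsRenaming v t e → IsRenaming (renTM suc ∘ v) (extsT t) (renT suc ∘ e)
IsRenaming-Λ R = record
  { ρv = ρv R ; ρt = liftR (ρt R) ; ρe = ρe R
  ; v≗ = cong (renTM suc) ∘ v≗ R ; t≗ = extsT-renaming (t≗ R) ; e≗ = cong (renT suc) ∘ e≗ R }

IsRenaming-ν : ∀ {v t e} → IsRenaming v t e → IsRenaming (renEM suc ∘ v) (renE suc ∘ t) (extsE e)
IsRenaming-ν R = record
  { ρv = ρv R ; ρt = ρt R ; ρe = liftR (ρe R)
  ; v≗ = cong (renEM suc) ∘ v≗ R ; t≗ = cong (renE suc) ∘ t≗ R ; e≗ = extsE-renaming (e≗ R) }

varRenaming : ∀ ρ → IsRenaming (var ∘ ρ) tv ev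
varRenaming ρ = record { ρv = ρ ; ρt = id ; ρe = id ; v≗ = ≗-refl ; t≗ = ≗-refl ; e≗ = ≗-refl }

tvRenaming : ∀ ρ → IsRenaming var (tv ∘ ρ) ev
tvRenaming ρ = record { ρv = id ; ρt = ρ ; ρe = id ; v≗ = ≗-refl ; t≗ = ≗-refl ; e≗ = ≗-refl }

evRenaming : ∀ ρ → IsRenaming var tv (ev ∘ ρ)
evRenaming ρ = record { ρv = id ; ρt = id ; ρe = ρ ; v≗ = ≗-refl ; t≗ = ≗-refl ; e≗ = ≗-refl }

subTm-renaming : ∀ {v₀ t₀ e₀} (R : IsRenaming v₀ t₀ e₀) v t e M →
                 subTm v t e (subTm v₀ t₀ e₀ M) ≡ subTm (v ∘ ρv R) (t ∘ ρt R) (e ∘ ρe R) M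
subTm-renaming R v t e (var n)   = cong (subTm v t e) (v≗ R n)
subTm-renaming R v t e (ƛ M)     = cong ƛ (trans (subTm-renaming (IsRenaming-ƛ R) (extsV v) t e M)
  (subTm-cong (extsV-liftR v (ρv R)) ≗-refl ≗-refl M))
subTm-renaming R v t e (M · N)   = cong₂ _·_ (subTm-renaming R v t e M) (subTm-renaming R v t e N)
subTm-renaming R v t e (Λ M)     = cong Λ (trans (subTm-renaming (IsRenaming-Λ R) _ (extsT t) _ M)
  (subTm-cong ≗-refl (extsT-liftR t (ρt R)) ≗-refl M))
subTm-renaming R v t e (M ·T A)  =
  cong₂ _·T_ (subTm-renaming R v t e M) (subTy-renaming (ρt R) (ρe R) (t≗ R) (e≗ R) t e A)
subTm-renaming R v t e ⋆         = refl
subTm-renaming R v t e (M ▷ N)   = cong₂ _▷_ (subTm-renaming R v t e M) (subTm-renaming R v t e N)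
subTm-renaming R v t e (gen A)   = cong gen (subTy-renaming (ρt R) (ρe R) (t≗ R) (e≗ R) t e A)
subTm-renaming R v t e (ver A M) =
  cong₂ ver (subTy-renaming (ρt R) (ρe R) (t≗ R) (e≗ R) t e A) (subTm-renaming R v t e M)
subTm-renaming R v t e (ν M)     = cong ν (trans (subTm-renaming (IsRenaming-ν R) _ _ (extsE e) M)
  (subTm-cong ≗-refl ≗-refl (extsE-liftR e (ρe R)) M))

renaming-renaming : ∀ {v₀ t₀ e₀ v₁ t₁ e₁} (R : IsRenaming v₀ t₀ e₀) (S : IsRenaming v₁ t₁ e₁) M →
  subTm v₁ t₁ e₁ (subTm v₀ t₀ e₀ M)
    ≡ subTm (var ∘ ρv S ∘ ρv R) (tv ∘ ρt S ∘ ρt R) (ev ∘ ρe S ∘ ρe R) M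
renaming-renaming R S M =
  trans (subTm-renaming R _ _ _ M) (subTm-cong (v≗ S ∘ ρv R) (t≗ S ∘ ρt R) (e≗ S ∘ ρe R) M)

renaming-subTm : ∀ {v₀ t₀ e₀} (R : IsRenaming v₀ t₀ e₀) v t e M →
  subTm v₀ t₀ e₀ (subTm v t e M)
    ≡ subTm (subTm v₀ t₀ e₀ ∘ v) (subTy t₀ e₀ ∘ t) (subTy t₀ e₀ ∘ e) M
renaming-subTm R v t e (var n)   = refl
renaming-subTm {v₀} {t₀} {e₀} R v t e (ƛ M) =
  cong ƛ (trans (renaming-subTm (IsRenaming-ƛ R) (extsV v) t e M) (subTm-cong lifted ≗-refl ≗-refl M))
  where
  lifted : subTm (extsV v₀) t₀ e₀ ∘ extsV v ≗ extsV (subTm v₀ t₀ e₀ ∘ v)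
  lifted zero    = refl
  lifted (suc n) = begin
    subTm (extsV v₀) t₀ e₀ (renV suc (v n))        ≡⟨ cong (subTm _ _ _) (renV-subTm suc (v n)) ⟩
    subTm (extsV v₀) t₀ e₀ (subTm (var ∘ suc) tv ev (v n))
                                                   ≡⟨ renaming-renaming (varRenaming suc) (IsRenaming-ƛ R) (v n) ⟩
    subTm (var ∘ suc ∘ ρv R) (tv ∘ ρt R) (ev ∘ ρe R) (v n)
                                                   ≡⟨ sym (renaming-renaming R (varRenaming suc) (v n)) ⟩
    subTm (var ∘ suc) tv ev (subTm v₀ t₀ e₀ (v n)) ≡⟨ sym (renV-subTm suc _) ⟩
    renV suc (subTm v₀ t₀ e₀ (v n))                ∎
    where open ≡-Reasoning
renaming-subTm R v t e (M · N)   = cong₂ _·_ (renaming-subTm R v t e M) (renaming-subTm R v t e N)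
renaming-subTm {v₀} {t₀} {e₀} R v t e (Λ M) =
  cong Λ (trans (renaming-subTm (IsRenaming-Λ R) _ (extsT t) _ M)
                (subTm-cong weakenedV lifted (subTy-weakenT t₀ e₀ ∘ e) M))
  where
  weakenedV : ∀ n → subTm (renTM suc ∘ v₀) (extsT t₀) (renT suc ∘ e₀) (renTM suc (v n))
                    ≡ renTM suc (subTm v₀ t₀ e₀ (v n))
  weakenedV n = begin
    subTm _ _ _ (renTM suc (v n))                  ≡⟨ cong (subTm _ _ _) (renTM-subTm suc (v n)) ⟩
    subTm _ _ _ (subTm var (tv ∘ suc) ev (v n))
                                                   ≡⟨ renaming-renaming (tvRenaming suc) (IsRenaming-Λ R) (v n) ⟩
    subTm (var ∘ ρv R) (tv ∘ suc ∘ ρt R) (ev ∘ ρe R) (v n)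
                                                   ≡⟨ sym (renaming-renaming R (tvRenaming suc) (v n)) ⟩
    subTm var (tv ∘ suc) ev (subTm v₀ t₀ e₀ (v n)) ≡⟨ sym (renTM-subTm suc _) ⟩
    renTM suc (subTm v₀ t₀ e₀ (v n))               ∎
    where open ≡-Reasoning
  lifted : subTy (extsT t₀) (renT suc ∘ e₀) ∘ extsT t ≗ extsT (subTy t₀ e₀ ∘ t)
  lifted zero    = refl
  lifted (suc n) = subTy-weakenT t₀ e₀ (t n)
renaming-subTm R v t e (M ·T A)  = cong₂ _·T_ (renaming-subTm R v t e M) (subTy-subTy _ _ t e A)
renaming-subTm R v t e ⋆         = refl
renaming-subTm R v t e (M ▷ N)   = cong₂ _▷_ (renaming-subTm R v t e M) (renaming-subTm R v t e N)
renaming-subTm R v t e (gen A)   = cong gen (subTy-subTy _ _ t e A)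
renaming-subTm R v t e (ver A M) = cong₂ ver (subTy-subTy _ _ t e A) (renaming-subTm R v t e M)
renaming-subTm {v₀} {t₀} {e₀} R v t e (ν M) =
  cong ν (trans (renaming-subTm (IsRenaming-ν R) _ _ (extsE e) M)
                (subTm-cong weakenedV (subTy-weakenE t₀ e₀ ∘ t) lifted M))
  where
  weakenedV : ∀ n → subTm (renEM suc ∘ v₀) (renE suc ∘ t₀) (extsE e₀) (renEM suc (v n))
                    ≡ renEM suc (subTm v₀ t₀ e₀ (v n))
  weakenedV n = begin
    subTm _ _ _ (renEM suc (v n))                  ≡⟨ cong (subTm _ _ _) (renEM-subTm suc (v n)) ⟩
    subTm _ _ _ (subTm var tv (ev ∘ suc) (v n))
                                        ≡⟨ renaming-renaming (evRenaming suc) (IsRenaming-ν R) (v n) ⟩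
    subTm (var ∘ ρv R) (tv ∘ ρt R) (ev ∘ suc ∘ ρe R) (v n)
                                                   ≡⟨ sym (renaming-renaming R (evRenaming suc) (v n)) ⟩
    subTm var tv (ev ∘ suc) (subTm v₀ t₀ e₀ (v n)) ≡⟨ sym (renEM-subTm suc _) ⟩
    renEM suc (subTm v₀ t₀ e₀ (v n))               ∎
    where open ≡-Reasoning
  lifted : subTy (renE suc ∘ t₀) (extsE e₀) ∘ extsE e ≗ extsE (subTy t₀ e₀ ∘ e)
  lifted zero    = refl
  lifted (suc n) = subTy-weakenE t₀ e₀ (e n)

subTm-weakenV : ∀ v t e M → subTm (extsV v) t e (renV suc M) ≡ renV suc (subTm v t e M)
subTm-weakenV v t e M = begin
  subTm (extsV v) t e (renV suc M)                  ≡⟨ cong (subTm _ _ _) (renV-subTm suc M) ⟩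
  subTm (extsV v) t e (subTm (var ∘ suc) tv ev M)   ≡⟨ subTm-renaming (varRenaming suc) _ _ _ M ⟩
  subTm (renV suc ∘ v) t e M
    ≡⟨ subTm-cong (renV-subTm suc ∘ v) (sym ∘ subTy-identity ∘ t) (sym ∘ subTy-identity ∘ e) M ⟩
  subTm (subTm (var ∘ suc) tv ev ∘ v) (subTy tv ev ∘ t) (subTy tv ev ∘ e) M
                                                    ≡⟨ sym (renaming-subTm (varRenaming suc) v t e M) ⟩
  subTm (var ∘ suc) tv ev (subTm v t e M)           ≡⟨ sym (renV-subTm suc _) ⟩
  renV suc (subTm v t e M)                          ∎
  where open ≡-Reasoning

subTm-weakenT : ∀ v t e M →
  subTm (renTM suc ∘ v) (extsT t) (renT suc ∘ e) (renTM suc M) ≡ renTM suc (subTm v t e M)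
subTm-weakenT v t e M = begin
  subTm (renTM suc ∘ v) (extsT t) (renT suc ∘ e) (renTM suc M)
    ≡⟨ cong (subTm _ _ _) (renTM-subTm suc M) ⟩
  subTm (renTM suc ∘ v) (extsT t) (renT suc ∘ e) (subTm var (tv ∘ suc) ev M)
    ≡⟨ subTm-renaming (tvRenaming suc) _ _ _ M ⟩
  subTm (renTM suc ∘ v) (renT suc ∘ t) (renT suc ∘ e) M
    ≡⟨ subTm-cong (renTM-subTm suc ∘ v) (renT-subTy suc ∘ t) (renT-subTy suc ∘ e) M ⟩
  subTm (subTm var (tv ∘ suc) ev ∘ v) (subTy (tv ∘ suc) ev ∘ t) (subTy (tv ∘ suc) ev ∘ e) M
    ≡⟨ sym (renaming-subTm (tvRenaming suc) v t e M) ⟩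
  subTm var (tv ∘ suc) ev (subTm v t e M)
    ≡⟨ sym (renTM-subTm suc _) ⟩
  renTM suc (subTm v t e M) ∎
  where open ≡-Reasoning

subTm-weakenE : ∀ v t e M →
  subTm (renEM suc ∘ v) (renE suc ∘ t) (extsE e) (renEM suc M) ≡ renEM suc (subTm v t e M)
subTm-weakenE v t e M = begin
  subTm (renEM suc ∘ v) (renE suc ∘ t) (extsE e) (renEM suc M)
    ≡⟨ cong (subTm _ _ _) (renEM-subTm suc M) ⟩
  subTm (renEM suc ∘ v) (renE suc ∘ t) (extsE e) (subTm var tv (ev ∘ suc) M)
    ≡⟨ subTm-renaming (evRenaming suc) _ _ _ M ⟩
  subTm (renEM suc ∘ v) (renE suc ∘ t) (renE suc ∘ e) M
    ≡⟨ subTm-cong (renEM-subTm suc ∘ v) (renE-subTy suc ∘ t) (renE-subTy suc ∘ e) M ⟩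
  subTm (subTm var tv (ev ∘ suc) ∘ v) (subTy tv (ev ∘ suc) ∘ t) (subTy tv (ev ∘ suc) ∘ e) M
    ≡⟨ sym (renaming-subTm (evRenaming suc) v t e M) ⟩
  subTm var tv (ev ∘ suc) (subTm v t e M)
    ≡⟨ sym (renEM-subTm suc _) ⟩
  renEM suc (subTm v t e M) ∎
  where open ≡-Reasoning

subTm-subTm : ∀ v′ t′ e′ v t e M →
  subTm v′ t′ e′ (subTm v t e M)
    ≡ subTm (subTm v′ t′ e′ ∘ v) (subTy t′ e′ ∘ t) (subTy t′ e′ ∘ e) M
subTm-subTm v′ t′ e′ v t e (var n)   = refl
subTm-subTm v′ t′ e′ v t e (ƛ M)     =
  cong ƛ (trans (subTm-subTm (extsV v′) t′ e′ (extsV v) t e M) (subTm-cong lifted ≗-refl ≗-refl M))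
  where
  lifted : subTm (extsV v′) t′ e′ ∘ extsV v ≗ extsV (subTm v′ t′ e′ ∘ v)
  lifted zero    = refl
  lifted (suc n) = subTm-weakenV v′ t′ e′ (v n)
subTm-subTm v′ t′ e′ v t e (M · N)   =
  cong₂ _·_ (subTm-subTm v′ t′ e′ v t e M) (subTm-subTm v′ t′ e′ v t e N)
subTm-subTm v′ t′ e′ v t e (Λ M)     =
  cong Λ (trans (subTm-subTm _ _ _ _ _ _ M)
                (subTm-cong (subTm-weakenT v′ t′ e′ ∘ v) lifted (subTy-weakenT t′ e′ ∘ e) M))
  where
  lifted : subTy (extsT t′) (renT suc ∘ e′) ∘ extsT t ≗ extsT (subTy t′ e′ ∘ t)
  lifted zero    = refl
  lifted (suc n) = subTy-weakenT t′ e′ (t n)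
subTm-subTm v′ t′ e′ v t e (M ·T A)  = cong₂ _·T_ (subTm-subTm v′ t′ e′ v t e M) (subTy-subTy t′ e′ t e A)
subTm-subTm v′ t′ e′ v t e ⋆         = refl
subTm-subTm v′ t′ e′ v t e (M ▷ N)   =
  cong₂ _▷_ (subTm-subTm v′ t′ e′ v t e M) (subTm-subTm v′ t′ e′ v t e N)
subTm-subTm v′ t′ e′ v t e (gen A)   = cong gen (subTy-subTy t′ e′ t e A)
subTm-subTm v′ t′ e′ v t e (ver A M) = cong₂ ver (subTy-subTy t′ e′ t e A) (subTm-subTm v′ t′ e′ v t e M)
subTm-subTm v′ t′ e′ v t e (ν M)     =
  cong ν (trans (subTm-subTm _ _ _ _ _ _ M)
                (subTm-cong (subTm-weakenE v′ t′ e′ ∘ v) (subTy-weakenE t′ e′ ∘ t) lifted M))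
  where
  lifted : subTy (renE suc ∘ t′) (extsE e′) ∘ extsE e ≗ extsE (subTy t′ e′ ∘ e)
  lifted zero    = refl
  lifted (suc n) = subTy-weakenE t′ e′ (e n)

cons : Tm → (ℕ → Tm) → ℕ → Tm
cons X φ zero    = X
cons X φ (suc n) = φ n

sub₀ : Tm → ℕ → Tm
sub₀ N = cons N var

subT₀ : Ty → ℕ → Ty
subT₀ B zero    = B
subT₀ B (suc n) = tv n

[]V-subTm : ∀ M N → M [ N ]V ≡ subTm (sub₀ N) tv ev M
[]V-subTm M N =
  trans (substV-subTm _ M) (subTm-cong (λ { zero → refl ; (suc n) → refl }) ≗-refl ≗-refl M)

[]TM-subTm : ∀ M A → M [ A ]TM ≡ subTm var (subT₀ A) ev M
[]TM-subTm M A =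
  trans (substTM-subTm _ M) (subTm-cong ≗-refl (λ { zero → refl ; (suc n) → refl }) ≗-refl M)

[]T-subTy : ∀ C A → C [ A ]T ≡ subTy (subT₀ A) ev C
[]T-subTy C A = trans (substT-subTy _ C) (subTy-cong (λ { zero → refl ; (suc n) → refl }) ≗-refl C)

subTy-subT₀-renT : ∀ B A → subTy (subT₀ B) ev (renT suc A) ≡ A
subTy-subT₀-renT B A = trans (cong (subTy _ _) (renT-subTy suc A))
  (trans (subTy-renaming suc id ≗-refl ≗-refl _ _ A) (subTy-identity A))

subTm-sub₀-renV : ∀ N M → subTm (sub₀ N) tv ev (renV suc M) ≡ M
subTm-sub₀-renV N M = trans (cong (subTm _ _ _) (renV-subTm suc M))
  (trans (subTm-renaming (varRenaming suc) _ _ _ M) (subTm-identity M))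

subTm-subT₀-renTM : ∀ B M → subTm var (subT₀ B) ev (renTM suc M) ≡ M
subTm-subT₀-renTM B M = trans (cong (subTm _ _ _) (renTM-subTm suc M))
  (trans (subTm-renaming (tvRenaming suc) _ _ _ M) (subTm-identity M))

subTm-[]V : ∀ v t e M N → (subTm (extsV v) t e M) [ subTm v t e N ]V ≡ subTm v t e (M [ N ]V)
subTm-[]V v t e M N = begin
  (subTm (extsV v) t e M) [ subTm v t e N ]V
    ≡⟨ []V-subTm (subTm (extsV v) t e M) (subTm v t e N) ⟩
  subTm (sub₀ (subTm v t e N)) tv ev (subTm (extsV v) t e M)
    ≡⟨ subTm-subTm _ _ _ _ _ _ M ⟩
  subTm (subTm (sub₀ (subTm v t e N)) tv ev ∘ extsV v) (subTy tv ev ∘ t) (subTy tv ev ∘ e) M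
    ≡⟨ subTm-cong substituted (subTy-identity ∘ t) (subTy-identity ∘ e) M ⟩
  subTm (subTm v t e ∘ sub₀ N) t e M
    ≡⟨ sym (subTm-subTm _ _ _ _ _ _ M) ⟩
  subTm v t e (subTm (sub₀ N) tv ev M)
    ≡⟨ cong (subTm v t e) (sym ([]V-subTm M N)) ⟩
  subTm v t e (M [ N ]V) ∎
  where
  open ≡-Reasoning
  substituted : subTm (sub₀ (subTm v t e N)) tv ev ∘ extsV v ≗ subTm v t e ∘ sub₀ N
  substituted zero    = refl
  substituted (suc n) = subTm-sub₀-renV _ (v n)

subTm-[]TM : ∀ v t e M A →
  (subTm (renTM suc ∘ v) (extsT t) (renT suc ∘ e) M) [ subTy t e A ]TM ≡ subTm v t e (M [ A ]TM)
subTm-[]TM v t e M A = begin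
  (subTm (renTM suc ∘ v) (extsT t) (renT suc ∘ e) M) [ subTy t e A ]TM
    ≡⟨ []TM-subTm (subTm (renTM suc ∘ v) (extsT t) (renT suc ∘ e) M) (subTy t e A) ⟩
  subTm var (subT₀ (subTy t e A)) ev (subTm (renTM suc ∘ v) (extsT t) (renT suc ∘ e) M)
    ≡⟨ subTm-subTm _ _ _ _ _ _ M ⟩
  subTm _ (subTy (subT₀ (subTy t e A)) ev ∘ extsT t) _ M
    ≡⟨ subTm-cong (subTm-subT₀-renTM _ ∘ v) substituted (subTy-subT₀-renT _ ∘ e) M ⟩
  subTm v (subTy t e ∘ subT₀ A) e M
    ≡⟨ sym (subTm-subTm _ _ _ _ _ _ M) ⟩
  subTm v t e (subTm var (subT₀ A) ev M)
    ≡⟨ cong (subTm v t e) (sym ([]TM-subTm M A)) ⟩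
  subTm v t e (M [ A ]TM) ∎
  where
  open ≡-Reasoning
  substituted : subTy (subT₀ (subTy t e A)) ev ∘ extsT t ≗ subTy t e ∘ subT₀ A
  substituted zero    = refl
  substituted (suc n) = subTy-subT₀-renT _ (t n)

subTy-[]T : ∀ t e A B → subTy t e (A [ B ]T) ≡ (subTy (extsT t) (renT suc ∘ e) A) [ subTy t e B ]T
subTy-[]T t e A B = begin
  subTy t e (A [ B ]T)                ≡⟨ cong (subTy t e) ([]T-subTy A B) ⟩
  subTy t e (subTy (subT₀ B) ev A)    ≡⟨ subTy-subTy _ _ _ _ A ⟩
  subTy (subTy t e ∘ subT₀ B) e A
    ≡⟨ subTy-cong substituted (sym ∘ subTy-subT₀-renT _ ∘ e) A ⟩
  subTy (subTy (subT₀ (subTy t e B)) ev ∘ extsT t) (subTy (subT₀ (subTy t e B)) ev ∘ renT suc ∘ e) A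
    ≡⟨ sym (subTy-subTy _ _ _ _ A) ⟩
  subTy (subT₀ (subTy t e B)) ev (subTy (extsT t) (renT suc ∘ e) A)
    ≡⟨ sym ([]T-subTy (subTy (extsT t) (renT suc ∘ e) A) (subTy t e B)) ⟩
  (subTy (extsT t) (renT suc ∘ e) A) [ subTy t e B ]T ∎
  where
  open ≡-Reasoning
  substituted : subTy t e ∘ subT₀ B ≗ subTy (subT₀ (subTy t e B)) ev ∘ extsT t
  substituted zero    = refl
  substituted (suc n) = sym (subTy-subT₀-renT _ (t n))

openSub : ℕ → Ty
openSub zero    = ev zero
openSub (suc n) = tv n

closeSub : ℕ → Ty
closeSub zero    = tv zero
closeSub (suc n) = ev n

openEv-subTy : ∀ A → openEv A ≡ subTy openSub (ev ∘ suc) A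
openEv-subTy A = begin
  openEv A                                        ≡⟨ []T-subTy (renE suc A) (ev zero) ⟩
  subTy (subT₀ (ev zero)) ev (renE suc A)         ≡⟨ cong (subTy _ _) (renE-subTy suc A) ⟩
  subTy (subT₀ (ev zero)) ev (subTy tv (ev ∘ suc) A)
                                                  ≡⟨ subTy-renaming id suc ≗-refl ≗-refl _ _ A ⟩
  subTy (subT₀ (ev zero)) (ev ∘ suc) A
                                ≡⟨ subTy-cong (λ { zero → refl ; (suc n) → refl }) ≗-refl A ⟩
  subTy openSub (ev ∘ suc) A                      ∎
  where open ≡-Reasoning

subTy-openSub-renT : ∀ A → subTy openSub (ev ∘ suc) (renT suc A) ≡ renE suc A
subTy-openSub-renT A = begin
  subTy openSub (ev ∘ suc) (renT suc A)       ≡⟨ cong (subTy _ _) (renT-subTy suc A) ⟩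
  subTy openSub (ev ∘ suc) (subTy (tv ∘ suc) ev A)
                                              ≡⟨ subTy-renaming suc id ≗-refl ≗-refl _ _ A ⟩
  subTy tv (ev ∘ suc) A                       ≡⟨ sym (renE-subTy suc A) ⟩
  renE suc A                                  ∎
  where open ≡-Reasoning

subTy-openEv : ∀ t e A →
  openEv (subTy (extsT t) (renT suc ∘ e) A) ≡ subTy (renE suc ∘ t) (extsE e) (openEv A)
subTy-openEv t e A = begin
  openEv (subTy (extsT t) (renT suc ∘ e) A)
    ≡⟨ openEv-subTy (subTy (extsT t) (renT suc ∘ e) A) ⟩
  subTy openSub (ev ∘ suc) (subTy (extsT t) (renT suc ∘ e) A)
    ≡⟨ subTy-subTy _ _ _ _ A ⟩
  subTy (subTy openSub (ev ∘ suc) ∘ extsT t) (subTy openSub (ev ∘ suc) ∘ renT suc ∘ e) A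
    ≡⟨ subTy-cong opened (subTy-openSub-renT ∘ e) A ⟩
  subTy (subTy (renE suc ∘ t) (extsE e) ∘ openSub) (subTy (renE suc ∘ t) (extsE e) ∘ ev ∘ suc) A
    ≡⟨ sym (subTy-subTy _ _ _ _ A) ⟩
  subTy (renE suc ∘ t) (extsE e) (subTy openSub (ev ∘ suc) A)
    ≡⟨ cong (subTy _ _) (sym (openEv-subTy A)) ⟩
  subTy (renE suc ∘ t) (extsE e) (openEv A) ∎
  where
  open ≡-Reasoning
  opened : subTy openSub (ev ∘ suc) ∘ extsT t ≗ subTy (renE suc ∘ t) (extsE e) ∘ openSub
  opened zero    = refl
  opened (suc n) = subTy-openSub-renT (t n)

renEM-renEM : ∀ ρ π M → renEM ρ (renEM π M) ≡ renEM (ρ ∘ π) M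
renEM-renEM ρ π M = begin
  renEM ρ (renEM π M)                          ≡⟨ cong₂ renEM refl (renEM-subTm π M) ⟩
  renEM ρ (subTm var tv (ev ∘ π) M)            ≡⟨ renEM-subTm ρ _ ⟩
  subTm var tv (ev ∘ ρ) (subTm var tv (ev ∘ π) M)
                                               ≡⟨ renaming-renaming (evRenaming π) (evRenaming ρ) M ⟩
  subTm var tv (ev ∘ ρ ∘ π) M                  ≡⟨ sym (renEM-subTm (ρ ∘ π) M) ⟩
  renEM (ρ ∘ π) M                              ∎
  where open ≡-Reasoning

renEM-id : ∀ M → renEM id M ≡ M
renEM-id M = trans (renEM-subTm id M) (subTm-identity M)

renEM-suc-injective : Injective _≡_ _≡_ (renEM suc)
renEM-suc-injective {M} {N} eq = begin
  M                        ≡⟨ sym (renEM-id M) ⟩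
  renEM (pred ∘ suc) M     ≡⟨ sym (renEM-renEM pred suc M) ⟩
  renEM pred (renEM suc M) ≡⟨ cong (renEM pred) eq ⟩
  renEM pred (renEM suc N) ≡⟨ renEM-renEM pred suc N ⟩
  renEM (pred ∘ suc) N     ≡⟨ renEM-id N ⟩
  N                        ∎
  where open ≡-Reasoning

renEM-[]V : ∀ ρ M N → (renEM ρ M) [ renEM ρ N ]V ≡ renEM ρ (M [ N ]V)
renEM-[]V ρ M N = begin
  (renEM ρ M) [ renEM ρ N ]V
    ≡⟨ cong₂ _[_]V (trans (renEM-subTm ρ M) (subTm-cong (sym ∘ extsV-var) ≗-refl ≗-refl M))
                   (renEM-subTm ρ N) ⟩
  (subTm (extsV var) tv (ev ∘ ρ) M) [ subTm var tv (ev ∘ ρ) N ]V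
    ≡⟨ subTm-[]V var tv (ev ∘ ρ) M N ⟩
  subTm var tv (ev ∘ ρ) (M [ N ]V)
    ≡⟨ sym (renEM-subTm ρ _) ⟩
  renEM ρ (M [ N ]V) ∎
  where open ≡-Reasoning

renEM-[]TM : ∀ ρ M A → (renEM ρ M) [ renE ρ A ]TM ≡ renEM ρ (M [ A ]TM)
renEM-[]TM ρ M A = begin
  (renEM ρ M) [ renE ρ A ]TM
    ≡⟨ cong₂ _[_]TM (trans (renEM-subTm ρ M) (subTm-cong ≗-refl (sym ∘ extsT-tv) ≗-refl M))
                    (renE-subTy ρ A) ⟩
  (subTm var (extsT tv) (ev ∘ ρ) M) [ subTy tv (ev ∘ ρ) A ]TM
    ≡⟨ subTm-[]TM var tv (ev ∘ ρ) M A ⟩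
  subTm var tv (ev ∘ ρ) (M [ A ]TM)
    ≡⟨ sym (renEM-subTm ρ _) ⟩
  renEM ρ (M [ A ]TM) ∎
  where open ≡-Reasoning

renE-openEv : ∀ ρ A → openEv (renE ρ A) ≡ renE (liftR ρ) (openEv A)
renE-openEv ρ A = begin
  openEv (renE ρ A)
    ≡⟨ cong openEv (trans (renE-subTy ρ A) (subTy-cong (sym ∘ extsT-tv) ≗-refl A)) ⟩
  openEv (subTy (extsT tv) (renT suc ∘ ev ∘ ρ) A)
    ≡⟨ subTy-openEv tv (ev ∘ ρ) A ⟩
  subTy tv (extsE (ev ∘ ρ)) (openEv A)
    ≡⟨ subTy-cong ≗-refl (extsE-renaming ≗-refl) (openEv A) ⟩
  subTy tv (ev ∘ liftR ρ) (openEv A)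
    ≡⟨ sym (renE-subTy (liftR ρ) _) ⟩
  renE (liftR ρ) (openEv A) ∎
  where open ≡-Reasoning

closeSub-openEv : ∀ A → subTy (tv ∘ suc) closeSub (openEv A) ≡ A
closeSub-openEv A = trans (cong (subTy _ _) (openEv-subTy A))
  (trans (subTy-subTy _ _ _ _ A) (subTy-id (λ { zero → refl ; (suc n) → refl }) ≗-refl A))

openEv-injective : Injective _≡_ _≡_ openEv
openEv-injective {A} {C} eq =
  trans (sym (closeSub-openEv A)) (trans (cong (subTy (tv ∘ suc) closeSub) eq) (closeSub-openEv C))

gen-[]TM : ∀ C B → (gen C) [ B ]TM ≡ gen (C [ B ]T)
gen-[]TM C B = trans ([]TM-subTm (gen C) B) (cong gen (sym ([]T-subTy C B)))

openEvTm : Tm → Tm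
openEvTm M = renEM suc M [ ev zero ]TM

openEvTm-subTm : ∀ M → openEvTm M ≡ subTm var openSub (ev ∘ suc) M
openEvTm-subTm M = begin
  openEvTm M                                          ≡⟨ []TM-subTm (renEM suc M) (ev zero) ⟩
  subTm var (subT₀ (ev zero)) ev (renEM suc M)        ≡⟨ cong (subTm _ _ _) (renEM-subTm suc M) ⟩
  subTm var (subT₀ (ev zero)) ev (subTm var tv (ev ∘ suc) M)
                                                      ≡⟨ subTm-renaming (evRenaming suc) _ _ _ M ⟩
  subTm var (subT₀ (ev zero)) (ev ∘ suc) M
                             ≡⟨ subTm-cong ≗-refl (λ { zero → refl ; (suc n) → refl }) ≗-refl M ⟩
  subTm var openSub (ev ∘ suc) M                      ∎
  where open ≡-Reasoning

openEvTm-renTM : ∀ M → openEvTm (renTM suc M) ≡ renEM suc M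
openEvTm-renTM M = begin
  openEvTm (renTM suc M)                           ≡⟨ openEvTm-subTm _ ⟩
  subTm var openSub (ev ∘ suc) (renTM suc M)       ≡⟨ cong (subTm _ _ _) (renTM-subTm suc M) ⟩
  subTm var openSub (ev ∘ suc) (subTm var (tv ∘ suc) ev M)
                                                   ≡⟨ subTm-renaming (tvRenaming suc) _ _ _ M ⟩
  subTm var tv (ev ∘ suc) M                        ≡⟨ sym (renEM-subTm suc M) ⟩
  renEM suc M                                      ∎
  where open ≡-Reasoning

closeSub-openEvTm : ∀ M → subTm var (tv ∘ suc) closeSub (openEvTm M) ≡ M
closeSub-openEvTm M = trans (cong (subTm _ _ _) (openEvTm-subTm M))
  (trans (subTm-subTm _ _ _ _ _ _ M) (subTm-id ≗-refl (λ { zero → refl ; (suc n) → refl }) ≗-refl M))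

closeSub-renE : ∀ A → subTy (tv ∘ suc) closeSub (renE suc A) ≡ renT suc A
closeSub-renE A = trans (cong (subTy _ _) (renE-subTy suc A))
  (trans (subTy-renaming id suc ≗-refl ≗-refl _ _ A) (sym (renT-subTy suc A)))

substV-extsV-[]V : ∀ φ X M → (substV (extsV φ) M) [ X ]V ≡ substV (cons X φ) M
substV-extsV-[]V φ X M = begin
  (substV (extsV φ) M) [ X ]V                         ≡⟨ []V-subTm (substV (extsV φ) M) X ⟩
  subTm (sub₀ X) tv ev (substV (extsV φ) M)           ≡⟨ cong (subTm _ _ _) (substV-subTm _ M) ⟩
  subTm (sub₀ X) tv ev (subTm (extsV φ) tv ev M)      ≡⟨ subTm-subTm _ _ _ _ _ _ M ⟩
  subTm (subTm (sub₀ X) tv ev ∘ extsV φ) tv ev M      ≡⟨ subTm-cong substituted ≗-refl ≗-refl M ⟩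
  subTm (cons X φ) tv ev M                            ≡⟨ sym (substV-subTm _ M) ⟩
  substV (cons X φ) M                                 ∎
  where
  open ≡-Reasoning
  substituted : subTm (sub₀ X) tv ev ∘ extsV φ ≗ cons X φ
  substituted zero    = refl
  substituted (suc n) = subTm-sub₀-renV X (φ n)

openEvTm-substV : ∀ φ M →
  openEvTm (substV (renTM suc ∘ φ) M) ≡ substV (renEM suc ∘ φ) (openEvTm M)
openEvTm-substV φ M = begin
  openEvTm (substV (renTM suc ∘ φ) M)
    ≡⟨ trans (openEvTm-subTm (substV (renTM suc ∘ φ) M)) (cong (subTm _ _ _) (substV-subTm _ M)) ⟩
  subTm var openSub (ev ∘ suc) (subTm (renTM suc ∘ φ) tv ev M)
    ≡⟨ subTm-subTm _ _ _ _ _ _ M ⟩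
  subTm (subTm var openSub (ev ∘ suc) ∘ renTM suc ∘ φ) openSub (ev ∘ suc) M
    ≡⟨ subTm-cong (λ n → trans (sym (openEvTm-subTm _)) (openEvTm-renTM (φ n)))
                  (sym ∘ subTy-identity ∘ openSub) ≗-refl M ⟩
  subTm (subTm (renEM suc ∘ φ) tv ev ∘ var) (subTy tv ev ∘ openSub) (subTy tv ev ∘ ev ∘ suc) M
    ≡⟨ sym (subTm-subTm _ _ _ _ _ _ M) ⟩
  subTm (renEM suc ∘ φ) tv ev (subTm var openSub (ev ∘ suc) M)
    ≡⟨ sym (trans (substV-subTm (renEM suc ∘ φ) (openEvTm M))
                  (cong (subTm _ _ _) (openEvTm-subTm M))) ⟩
  substV (renEM suc ∘ φ) (openEvTm M) ∎
  where open ≡-Reasoning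

-- Rule (9) is taken in the form pν-drop, which only asks the body to reduce to a term free of
-- the bound eigenvariable; this keeps the diamond property within reach of renaming inversion.
infix 4 _⇛_

data _⇛_ : Tm → Tm → Set where
  pvar    : var n ⇛ var n
  pƛ      : M ⇛ M′ → ƛ M ⇛ ƛ M′
  p·      : M ⇛ M′ → N ⇛ N′ → M · N ⇛ M′ · N′
  pΛ      : M ⇛ M′ → Λ M ⇛ Λ M′
  p·T     : M ⇛ M′ → M ·T A ⇛ M′ ·T A
  p⋆      : ⋆ ⇛ ⋆
  p▷      : M ⇛ M′ → N ⇛ N′ → (M ▷ N) ⇛ (M′ ▷ N′)
  pgen    : gen A ⇛ gen A
  pver    : M ⇛ M′ → ver A M ⇛ ver A M′
  pν      : M ⇛ M′ → ν M ⇛ ν M′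
  pβƛ     : M ⇛ M′ → N ⇛ N′ → ƛ M · N ⇛ M′ [ N′ ]V
  pβΛ     : M ⇛ M′ → Λ M ·T A ⇛ M′ [ A ]TM
  p⋆▷     : M ⇛ M′ → (⋆ ▷ M) ⇛ M′
  pver-ev : ver (ev n) (gen (ev n)) ⇛ ⋆
  pgen-⇒  : gen (A ⇒ B) ⇛ ƛ (ver A (var zero) ▷ gen B)
  pver-⇒  : M ⇛ M′ → ver (A ⇒ B) M ⇛ ver B (M′ · gen A)
  pgen-∀  : gen (∀' A) ⇛ Λ (gen A)
  pver-∀  : M ⇛ M′ → ver (∀' A) M ⇛ ν (ver (openEv A) (renEM suc M′ ·T ev zero))
  pν-drop : M ⇛ renEM suc M′ → ν M ⇛ M′

⇛-refl : ∀ M → M ⇛ M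
⇛-refl (var n)   = pvar
⇛-refl (ƛ M)     = pƛ (⇛-refl M)
⇛-refl (M · N)   = p· (⇛-refl M) (⇛-refl N)
⇛-refl (Λ M)     = pΛ (⇛-refl M)
⇛-refl (M ·T A)  = p·T (⇛-refl M)
⇛-refl ⋆         = p⋆
⇛-refl (M ▷ N)   = p▷ (⇛-refl M) (⇛-refl N)
⇛-refl (gen A)   = pgen
⇛-refl (ver A M) = pver (⇛-refl M)
⇛-refl (ν M)     = pν (⇛-refl M)

⟶⇒⇛ : M ⟶ N → M ⇛ N
⟶⇒⇛ β-ƛ      = pβƛ (⇛-refl _) (⇛-refl _)
⟶⇒⇛ β-Λ      = pβΛ (⇛-refl _)
⟶⇒⇛ r-▷      = p⋆▷ (⇛-refl _)
⟶⇒⇛ r-ver-ev = pver-ev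
⟶⇒⇛ r-gen-⇒  = pgen-⇒
⟶⇒⇛ r-ver-⇒  = pver-⇒ (⇛-refl _)
⟶⇒⇛ r-gen-∀  = pgen-∀
⟶⇒⇛ r-ver-∀  = pver-∀ (⇛-refl _)
⟶⇒⇛ r-ν      = pν-drop (⇛-refl _)
⟶⇒⇛ (ξ-ƛ s)  = pƛ (⟶⇒⇛ s)
⟶⇒⇛ (ξ-·₁ s) = p· (⟶⇒⇛ s) (⇛-refl _)
⟶⇒⇛ (ξ-·₂ s) = p· (⇛-refl _) (⟶⇒⇛ s)
⟶⇒⇛ (ξ-Λ s)  = pΛ (⟶⇒⇛ s)
⟶⇒⇛ (ξ-·T s) = p·T (⟶⇒⇛ s)
⟶⇒⇛ (ξ-▷₁ s) = p▷ (⟶⇒⇛ s) (⇛-refl _)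
⟶⇒⇛ (ξ-▷₂ s) = p▷ (⇛-refl _) (⟶⇒⇛ s)
⟶⇒⇛ (ξ-ver s) = pver (⟶⇒⇛ s)
⟶⇒⇛ (ξ-ν s)  = pν (⟶⇒⇛ s)

↠-· : M ↠ M′ → N ↠ N′ → M · N ↠ M′ · N′
↠-· r s = gmap (_· _) ξ-·₁ r ◅◅ gmap (_ ·_) ξ-·₂ s

↠-▷ : M ↠ M′ → N ↠ N′ → (M ▷ N) ↠ (M′ ▷ N′)
↠-▷ r s = gmap (_▷ _) ξ-▷₁ r ◅◅ gmap (_ ▷_) ξ-▷₂ s

⇛⇒↠ : M ⇛ N → M ↠ N
⇛⇒↠ pvar        = ε
⇛⇒↠ (pƛ d)      = gmap ƛ ξ-ƛ (⇛⇒↠ d)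
⇛⇒↠ (p· d e)    = ↠-· (⇛⇒↠ d) (⇛⇒↠ e)
⇛⇒↠ (pΛ d)      = gmap Λ ξ-Λ (⇛⇒↠ d)
⇛⇒↠ (p·T d)     = gmap (_·T _) ξ-·T (⇛⇒↠ d)
⇛⇒↠ p⋆          = ε
⇛⇒↠ (p▷ d e)    = ↠-▷ (⇛⇒↠ d) (⇛⇒↠ e)
⇛⇒↠ pgen        = ε
⇛⇒↠ (pver d)    = gmap (ver _) ξ-ver (⇛⇒↠ d)
⇛⇒↠ (pν d)      = gmap ν ξ-ν (⇛⇒↠ d)
⇛⇒↠ (pβƛ d e)   = ↠-· (gmap ƛ ξ-ƛ (⇛⇒↠ d)) (⇛⇒↠ e) ◅◅ return β-ƛ
⇛⇒↠ (pβΛ {A = A} d) = gmap (_·T A) ξ-·T (gmap Λ ξ-Λ (⇛⇒↠ d)) ◅◅ return β-Λ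
⇛⇒↠ (p⋆▷ d)     = r-▷ ◅ ⇛⇒↠ d
⇛⇒↠ pver-ev     = return r-ver-ev
⇛⇒↠ pgen-⇒      = return r-gen-⇒
⇛⇒↠ (pver-⇒ d)  = gmap (ver _) ξ-ver (⇛⇒↠ d) ◅◅ return r-ver-⇒
⇛⇒↠ pgen-∀      = return r-gen-∀
⇛⇒↠ (pver-∀ d)  = gmap (ver _) ξ-ver (⇛⇒↠ d) ◅◅ return r-ver-∀
⇛⇒↠ (pν-drop d) = gmap ν ξ-ν (⇛⇒↠ d) ◅◅ return r-ν

-- The eigenvariable part must stay a renaming because of the rule ver 𝐚 (gen 𝐚) ⇛ ⋆.
⇛-subTm : ∀ {v t e} → e ≗ ev ∘ ρ → M ⇛ M′ → subTm v t e M ⇛ subTm v t e M′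
⇛-subTm {v = v} e≗ pvar = ⇛-refl (v _)
⇛-subTm e≗ (pƛ d)     = pƛ (⇛-subTm e≗ d)
⇛-subTm e≗ (p· d d′)  = p· (⇛-subTm e≗ d) (⇛-subTm e≗ d′)
⇛-subTm e≗ (pΛ d)     = pΛ (⇛-subTm (cong (renT suc) ∘ e≗) d)
⇛-subTm e≗ (p·T d)    = p·T (⇛-subTm e≗ d)
⇛-subTm e≗ p⋆         = p⋆
⇛-subTm e≗ (p▷ d d′)  = p▷ (⇛-subTm e≗ d) (⇛-subTm e≗ d′)
⇛-subTm e≗ pgen       = pgen
⇛-subTm e≗ (pver d)   = pver (⇛-subTm e≗ d)
⇛-subTm e≗ (pν d)     = pν (⇛-subTm (extsE-renaming e≗) d)
⇛-subTm {v = v} {t} {e} e≗ (pβƛ {M′ = M′} {N′ = N′} d d′) =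
  subst (_ ⇛_) (subTm-[]V v t e M′ N′) (pβƛ (⇛-subTm e≗ d) (⇛-subTm e≗ d′))
⇛-subTm {v = v} {t} {e} e≗ (pβΛ {M′ = M′} {A = A} d) =
  subst (_ ⇛_) (subTm-[]TM v t e M′ A) (pβΛ (⇛-subTm (cong (renT suc) ∘ e≗) d))
⇛-subTm e≗ (p⋆▷ d)    = p⋆▷ (⇛-subTm e≗ d)
⇛-subTm e≗ (pver-ev {n = n}) = subst (λ C → ver C (gen C) ⇛ ⋆) (sym (e≗ n)) pver-ev
⇛-subTm e≗ pgen-⇒     = pgen-⇒
⇛-subTm e≗ (pver-⇒ d) = pver-⇒ (⇛-subTm e≗ d)
⇛-subTm e≗ pgen-∀     = pgen-∀
⇛-subTm {v = v} {t} {e} e≗ (pver-∀ {M = M} {M′ = M′} {A = A} d) =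
  subst (subTm v t e (ver (∀' A) M) ⇛_)
        (cong₂ (λ C Y → ν (ver C (Y ·T ev zero))) (subTy-openEv t e A) (sym (subTm-weakenE v t e M′)))
        (pver-∀ (⇛-subTm e≗ d))
⇛-subTm {v = v} {t} {e} e≗ (pν-drop {M′ = M′} d) =
  pν-drop (subst (_ ⇛_) (subTm-weakenE v t e M′) (⇛-subTm (extsE-renaming e≗) d))

⇛-renV : ∀ ρ → M ⇛ M′ → renV ρ M ⇛ renV ρ M′
⇛-renV {M} {M′} ρ d =
  subst₂ _⇛_ (sym (renV-subTm ρ M)) (sym (renV-subTm ρ M′)) (⇛-subTm {ρ = id} ≗-refl d)

⇛-renTM : ∀ ρ → M ⇛ M′ → renTM ρ M ⇛ renTM ρ M′
⇛-renTM {M} {M′} ρ d =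
  subst₂ _⇛_ (sym (renTM-subTm ρ M)) (sym (renTM-subTm ρ M′)) (⇛-subTm {ρ = id} ≗-refl d)

⇛-renEM : ∀ ρ → M ⇛ M′ → renEM ρ M ⇛ renEM ρ M′
⇛-renEM {M} {M′} ρ d =
  subst₂ _⇛_ (sym (renEM-subTm ρ M)) (sym (renEM-subTm ρ M′)) (⇛-subTm ≗-refl d)

extsV-⇛ : ∀ {v v′} → (∀ n → v n ⇛ v′ n) → ∀ n → extsV v n ⇛ extsV v′ n
extsV-⇛ v⇛ zero    = pvar
extsV-⇛ v⇛ (suc n) = ⇛-renV suc (v⇛ n)

⇛-subTm-⇛ : ∀ {v v′ t e} → (∀ n → v n ⇛ v′ n) → e ≗ ev ∘ ρ → M ⇛ M′ →
            subTm v t e M ⇛ subTm v′ t e M′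
⇛-subTm-⇛ v⇛ e≗ pvar       = v⇛ _
⇛-subTm-⇛ v⇛ e≗ (pƛ d)     = pƛ (⇛-subTm-⇛ (extsV-⇛ v⇛) e≗ d)
⇛-subTm-⇛ v⇛ e≗ (p· d d′)  = p· (⇛-subTm-⇛ v⇛ e≗ d) (⇛-subTm-⇛ v⇛ e≗ d′)
⇛-subTm-⇛ v⇛ e≗ (pΛ d)     = pΛ (⇛-subTm-⇛ (⇛-renTM suc ∘ v⇛) (cong (renT suc) ∘ e≗) d)
⇛-subTm-⇛ v⇛ e≗ (p·T d)    = p·T (⇛-subTm-⇛ v⇛ e≗ d)
⇛-subTm-⇛ v⇛ e≗ p⋆         = p⋆
⇛-subTm-⇛ v⇛ e≗ (p▷ d d′)  = p▷ (⇛-subTm-⇛ v⇛ e≗ d) (⇛-subTm-⇛ v⇛ e≗ d′)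
⇛-subTm-⇛ v⇛ e≗ pgen       = pgen
⇛-subTm-⇛ v⇛ e≗ (pver d)   = pver (⇛-subTm-⇛ v⇛ e≗ d)
⇛-subTm-⇛ v⇛ e≗ (pν d)     = pν (⇛-subTm-⇛ (⇛-renEM suc ∘ v⇛) (extsE-renaming e≗) d)
⇛-subTm-⇛ {v′ = v′} {t} {e} v⇛ e≗ (pβƛ {M′ = M′} {N′ = N′} d d′) =
  subst (_ ⇛_) (subTm-[]V v′ t e M′ N′)
        (pβƛ (⇛-subTm-⇛ (extsV-⇛ v⇛) e≗ d) (⇛-subTm-⇛ v⇛ e≗ d′))
⇛-subTm-⇛ {v′ = v′} {t} {e} v⇛ e≗ (pβΛ {M′ = M′} {A = A} d) =
  subst (_ ⇛_) (subTm-[]TM v′ t e M′ A)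
        (pβΛ (⇛-subTm-⇛ (⇛-renTM suc ∘ v⇛) (cong (renT suc) ∘ e≗) d))
⇛-subTm-⇛ v⇛ e≗ (p⋆▷ d)    = p⋆▷ (⇛-subTm-⇛ v⇛ e≗ d)
⇛-subTm-⇛ v⇛ e≗ (pver-ev {n = n}) = subst (λ C → ver C (gen C) ⇛ ⋆) (sym (e≗ n)) pver-ev
⇛-subTm-⇛ v⇛ e≗ pgen-⇒     = pgen-⇒
⇛-subTm-⇛ v⇛ e≗ (pver-⇒ d) = pver-⇒ (⇛-subTm-⇛ v⇛ e≗ d)
⇛-subTm-⇛ v⇛ e≗ pgen-∀     = pgen-∀
⇛-subTm-⇛ {v = v} {v′} {t} {e} v⇛ e≗ (pver-∀ {M = M} {M′ = M′} {A = A} d) =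
  subst (subTm v t e (ver (∀' A) M) ⇛_)
        (cong₂ (λ C Y → ν (ver C (Y ·T ev zero))) (subTy-openEv t e A) (sym (subTm-weakenE v′ t e M′)))
        (pver-∀ (⇛-subTm-⇛ v⇛ e≗ d))
⇛-subTm-⇛ {v′ = v′} {t} {e} v⇛ e≗ (pν-drop {M′ = M′} d) =
  pν-drop (subst (_ ⇛_) (subTm-weakenE v′ t e M′)
                 (⇛-subTm-⇛ (⇛-renEM suc ∘ v⇛) (extsE-renaming e≗) d))

⇛-[]V : M ⇛ M′ → N ⇛ N′ → M [ N ]V ⇛ M′ [ N′ ]V
⇛-[]V {M} {M′} {N} {N′} d e =
  subst₂ _⇛_ (sym ([]V-subTm M N)) (sym ([]V-subTm M′ N′)) (⇛-subTm-⇛ {ρ = id} sub₀-⇛ ≗-refl d)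
  where
  sub₀-⇛ : ∀ n → sub₀ N n ⇛ sub₀ N′ n
  sub₀-⇛ zero    = e
  sub₀-⇛ (suc n) = pvar

⇛-[]TM : ∀ A → M ⇛ M′ → M [ A ]TM ⇛ M′ [ A ]TM
⇛-[]TM {M} {M′} A d =
  subst₂ _⇛_ (sym ([]TM-subTm M A)) (sym ([]TM-subTm M′ A)) (⇛-subTm {ρ = id} ≗-refl d)

-- Injective renamings of eigenvariables reflect parallel reduction

infixr 7 _⇒ʳ_
infixl 6 _·ʳ_ _·Tʳ_
infix 5 _▷ʳ_

-- RenTy ρ A A′ and RenTm ρ M M′ are the graphs of renE ρ and renEM ρ; unlike equations
-- A′ ≡ renE ρ A, they can be inverted by pattern matching.
data RenTy (ρ : ℕ → ℕ) : Ty → Ty → Set where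
  tvʳ  : RenTy ρ (tv n) (tv n)
  evʳ  : ρ m ≡ n → RenTy ρ (ev m) (ev n)
  _⇒ʳ_ : RenTy ρ A A′ → RenTy ρ B B′ → RenTy ρ (A ⇒ B) (A′ ⇒ B′)
  ∀ʳ   : RenTy ρ A A′ → RenTy ρ (∀' A) (∀' A′)

data RenTm : (ℕ → ℕ) → Tm → Tm → Set where
  varʳ  : RenTm ρ (var n) (var n)
  ƛʳ    : RenTm ρ M M′ → RenTm ρ (ƛ M) (ƛ M′)
  _·ʳ_  : RenTm ρ M M′ → RenTm ρ N N′ → RenTm ρ (M · N) (M′ · N′)
  Λʳ    : RenTm ρ M M′ → RenTm ρ (Λ M) (Λ M′)
  _·Tʳ_ : RenTm ρ M M′ → RenTy ρ A A′ → RenTm ρ (M ·T A) (M′ ·T A′)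
  ⋆ʳ    : RenTm ρ ⋆ ⋆
  _▷ʳ_  : RenTm ρ M M′ → RenTm ρ N N′ → RenTm ρ (M ▷ N) (M′ ▷ N′)
  genʳ  : RenTy ρ A A′ → RenTm ρ (gen A) (gen A′)
  verʳ  : RenTy ρ A A′ → RenTm ρ M M′ → RenTm ρ (ver A M) (ver A′ M′)
  νʳ    : RenTm (liftR ρ) M M′ → RenTm ρ (ν M) (ν M′)

RenTy-renE : ∀ ρ A → RenTy ρ A (renE ρ A)
RenTy-renE ρ (tv n)  = tvʳ
RenTy-renE ρ (ev n)  = evʳ refl
RenTy-renE ρ (A ⇒ B) = RenTy-renE ρ A ⇒ʳ RenTy-renE ρ B
RenTy-renE ρ (∀' A)  = ∀ʳ (RenTy-renE ρ A)

renE-RenTy : RenTy ρ A A′ → A′ ≡ renE ρ A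
renE-RenTy tvʳ        = refl
renE-RenTy (evʳ refl) = refl
renE-RenTy (a ⇒ʳ b)   = cong₂ _⇒_ (renE-RenTy a) (renE-RenTy b)
renE-RenTy (∀ʳ a)     = cong ∀' (renE-RenTy a)

RenTm-renEM : ∀ ρ M → RenTm ρ M (renEM ρ M)
RenTm-renEM ρ (var n)   = varʳ
RenTm-renEM ρ (ƛ M)     = ƛʳ (RenTm-renEM ρ M)
RenTm-renEM ρ (M · N)   = RenTm-renEM ρ M ·ʳ RenTm-renEM ρ N
RenTm-renEM ρ (Λ M)     = Λʳ (RenTm-renEM ρ M)
RenTm-renEM ρ (M ·T A)  = RenTm-renEM ρ M ·Tʳ RenTy-renE ρ A
RenTm-renEM ρ ⋆         = ⋆ʳ
RenTm-renEM ρ (M ▷ N)   = RenTm-renEM ρ M ▷ʳ RenTm-renEM ρ N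
RenTm-renEM ρ (gen A)   = genʳ (RenTy-renE ρ A)
RenTm-renEM ρ (ver A M) = verʳ (RenTy-renE ρ A) (RenTm-renEM ρ M)
RenTm-renEM ρ (ν M)     = νʳ (RenTm-renEM (liftR ρ) M)

renEM-RenTm : RenTm ρ M M′ → M′ ≡ renEM ρ M
renEM-RenTm varʳ       = refl
renEM-RenTm (ƛʳ m)     = cong ƛ (renEM-RenTm m)
renEM-RenTm (m ·ʳ n)   = cong₂ _·_ (renEM-RenTm m) (renEM-RenTm n)
renEM-RenTm (Λʳ m)     = cong Λ (renEM-RenTm m)
renEM-RenTm (m ·Tʳ a)  = cong₂ _·T_ (renEM-RenTm m) (renE-RenTy a)
renEM-RenTm ⋆ʳ         = refl
renEM-RenTm (m ▷ʳ n)   = cong₂ _▷_ (renEM-RenTm m) (renEM-RenTm n)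
renEM-RenTm (genʳ a)   = cong gen (renE-RenTy a)
renEM-RenTm (verʳ a m) = cong₂ ver (renE-RenTy a) (renEM-RenTm m)
renEM-RenTm (νʳ m)     = cong ν (renEM-RenTm m)

Pullback : (f g g′ f′ : ℕ → ℕ) → Set
Pullback f g g′ f′ = ∀ {n m} → f n ≡ g m → Σ ℕ λ k → n ≡ g′ k × m ≡ f′ k

Pullback-liftR : Pullback f g g′ f′ → Pullback (liftR f) (liftR g) (liftR g′) (liftR f′)
Pullback-liftR P {zero}  {zero}  eq = zero , refl , refl
Pullback-liftR P {suc n} {suc m} eq with P (suc-injective eq)
... | k , refl , refl = suc k , refl , refl

Pullback-liftR-suc : ∀ ρ → Pullback (liftR ρ) suc suc ρ
Pullback-liftR-suc ρ {suc n} refl = n , refl , refl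

RenTy-pullback : ∀ {A B C} → Pullback f g g′ f′ → RenTy f A C → RenTy g B C →
                 Σ Ty λ W → RenTy g′ W A × RenTy f′ W B
RenTy-pullback P tvʳ tvʳ = tv _ , tvʳ , tvʳ
RenTy-pullback P (evʳ p) (evʳ q) with P (trans p (sym q))
... | k , refl , refl = ev k , evʳ refl , evʳ refl
RenTy-pullback P (a ⇒ʳ b) (c ⇒ʳ d) with RenTy-pullback P a c | RenTy-pullback P b d
... | W₁ , x₁ , y₁ | W₂ , x₂ , y₂ = W₁ ⇒ W₂ , x₁ ⇒ʳ x₂ , y₁ ⇒ʳ y₂
RenTy-pullback P (∀ʳ a) (∀ʳ c) with RenTy-pullback P a c
... | W , x , y = ∀' W , ∀ʳ x , ∀ʳ y

RenTm-pullback : Pullback f g g′ f′ → RenTm f M X → RenTm g N X →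
                 Σ Tm λ W → RenTm g′ W M × RenTm f′ W N
RenTm-pullback P varʳ varʳ = var _ , varʳ , varʳ
RenTm-pullback P (ƛʳ m) (ƛʳ n) with RenTm-pullback P m n
... | W , x , y = ƛ W , ƛʳ x , ƛʳ y
RenTm-pullback P (m₁ ·ʳ m₂) (n₁ ·ʳ n₂) with RenTm-pullback P m₁ n₁ | RenTm-pullback P m₂ n₂
... | W₁ , x₁ , y₁ | W₂ , x₂ , y₂ = W₁ · W₂ , x₁ ·ʳ x₂ , y₁ ·ʳ y₂
RenTm-pullback P (Λʳ m) (Λʳ n) with RenTm-pullback P m n
... | W , x , y = Λ W , Λʳ x , Λʳ y
RenTm-pullback P (m ·Tʳ a) (n ·Tʳ b) with RenTm-pullback P m n | RenTy-pullback P a b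
... | W , x , y | C , c , d = W ·T C , x ·Tʳ c , y ·Tʳ d
RenTm-pullback P ⋆ʳ ⋆ʳ = ⋆ , ⋆ʳ , ⋆ʳ
RenTm-pullback P (m₁ ▷ʳ m₂) (n₁ ▷ʳ n₂) with RenTm-pullback P m₁ n₁ | RenTm-pullback P m₂ n₂
... | W₁ , x₁ , y₁ | W₂ , x₂ , y₂ = (W₁ ▷ W₂) , x₁ ▷ʳ x₂ , y₁ ▷ʳ y₂
RenTm-pullback P (genʳ a) (genʳ b) with RenTy-pullback P a b
... | C , c , d = gen C , genʳ c , genʳ d
RenTm-pullback P (verʳ a m) (verʳ b n) with RenTy-pullback P a b | RenTm-pullback P m n
... | C , c , d | W , x , y = ver C W , verʳ c x , verʳ d y
RenTm-pullback P (νʳ m) (νʳ n) with RenTm-pullback (Pullback-liftR P) m n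
... | W , x , y = ν W , νʳ x , νʳ y

renEM-liftR-suc-pullback : ∀ ρ {Y Z} → renEM (liftR ρ) Y ≡ renEM suc Z →
                           Σ Tm λ W → Y ≡ renEM suc W × Z ≡ renEM ρ W
renEM-liftR-suc-pullback ρ {Y} {Z} eq
  with RenTm-pullback (Pullback-liftR-suc ρ) (RenTm-renEM (liftR ρ) Y)
                      (subst (RenTm suc Z) (sym eq) (RenTm-renEM suc Z))
... | W , y , z = W , renEM-RenTm y , renEM-RenTm z

liftR-injective : Injective _≡_ _≡_ ρ → Injective _≡_ _≡_ (liftR ρ)
liftR-injective inj {zero}  {zero}  eq = refl
liftR-injective inj {suc m} {suc n} eq = cong suc (inj (suc-injective eq))

⇛-unrename : Injective _≡_ _≡_ ρ → RenTm ρ M X → X ⇛ X′ →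
             Σ Tm λ M′ → M ⇛ M′ × X′ ≡ renEM ρ M′
⇛-unrename inj varʳ pvar = _ , pvar , refl
⇛-unrename inj (ƛʳ m) (pƛ d) with ⇛-unrename inj m d
... | M′ , d′ , refl = ƛ M′ , pƛ d′ , refl
⇛-unrename inj (m ·ʳ n) (p· d e) with ⇛-unrename inj m d | ⇛-unrename inj n e
... | M′ , d′ , refl | N′ , e′ , refl = M′ · N′ , p· d′ e′ , refl
⇛-unrename {ρ = ρ} inj (ƛʳ m ·ʳ n) (pβƛ d e) with ⇛-unrename inj m d | ⇛-unrename inj n e
... | M′ , d′ , refl | N′ , e′ , refl = M′ [ N′ ]V , pβƛ d′ e′ , renEM-[]V ρ M′ N′
⇛-unrename inj (Λʳ m) (pΛ d) with ⇛-unrename inj m d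
... | M′ , d′ , refl = Λ M′ , pΛ d′ , refl
⇛-unrename inj (m ·Tʳ a) (p·T d) with ⇛-unrename inj m d | renE-RenTy a
... | M′ , d′ , refl | refl = M′ ·T _ , p·T d′ , refl
⇛-unrename {ρ = ρ} inj (Λʳ m ·Tʳ a) (pβΛ d) with ⇛-unrename inj m d | renE-RenTy a
... | M′ , d′ , refl | refl = M′ [ _ ]TM , pβΛ d′ , renEM-[]TM ρ M′ _
⇛-unrename inj ⋆ʳ p⋆ = ⋆ , p⋆ , refl
⇛-unrename inj (m ▷ʳ n) (p▷ d e) with ⇛-unrename inj m d | ⇛-unrename inj n e
... | M′ , d′ , refl | N′ , e′ , refl = (M′ ▷ N′) , p▷ d′ e′ , refl
⇛-unrename inj (⋆ʳ ▷ʳ n) (p⋆▷ d) with ⇛-unrename inj n d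
... | N′ , d′ , eq = N′ , p⋆▷ d′ , eq
⇛-unrename inj (genʳ a) pgen with renE-RenTy a
... | refl = gen _ , pgen , refl
⇛-unrename inj (genʳ (a ⇒ʳ b)) pgen-⇒ with renE-RenTy a | renE-RenTy b
... | refl | refl = _ , pgen-⇒ , refl
⇛-unrename inj (genʳ (∀ʳ a)) pgen-∀ with renE-RenTy a
... | refl = _ , pgen-∀ , refl
⇛-unrename inj (verʳ a m) (pver d) with ⇛-unrename inj m d | renE-RenTy a
... | M′ , d′ , refl | refl = ver _ M′ , pver d′ , refl
⇛-unrename inj (verʳ (evʳ p) (genʳ (evʳ q))) pver-ev with inj (trans p (sym q))
... | refl = ⋆ , pver-ev , refl
⇛-unrename inj (verʳ (a ⇒ʳ b) m) (pver-⇒ d) with ⇛-unrename inj m d | renE-RenTy a | renE-RenTy b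
... | M′ , d′ , refl | refl | refl = _ , pver-⇒ d′ , refl
⇛-unrename {ρ = ρ} inj (verʳ (∀ʳ {A = A} a) m) (pver-∀ d) with ⇛-unrename inj m d | renE-RenTy a
... | M′ , d′ , refl | refl =
  _ , pver-∀ d′ ,
  cong₂ (λ C Y → ν (ver C (Y ·T ev zero))) (renE-openEv ρ A)
        (trans (renEM-renEM suc ρ M′) (sym (renEM-renEM (liftR ρ) suc M′)))
⇛-unrename inj (νʳ m) (pν d) with ⇛-unrename (liftR-injective inj) m d
... | M′ , d′ , refl = ν M′ , pν d′ , refl
⇛-unrename {ρ = ρ} inj (νʳ m) (pν-drop d) with ⇛-unrename (liftR-injective inj) m d
... | Y′ , d′ , eq with renEM-liftR-suc-pullback ρ (sym eq)
... | W , refl , refl = W , pν-drop d′ , refl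

renEM-⇛-inv : Injective _≡_ _≡_ ρ → renEM ρ M ⇛ X′ →
              Σ Tm λ M′ → M ⇛ M′ × X′ ≡ renEM ρ M′
renEM-⇛-inv {ρ = ρ} {M} inj = ⇛-unrename inj (RenTm-renEM ρ M)

Joinable : Tm → Tm → Set
Joinable N₁ N₂ = Σ Tm λ P → N₁ ⇛ P × N₂ ⇛ P

⇛-diamond     : M ⇛ N₁ → M ⇛ N₂ → Joinable N₁ N₂
⇛-diamond-ver : ver A M ⇛ N₁ → ver A M ⇛ N₂ → Joinable N₁ N₂
⇛-diamond-ν   : ν M ⇛ N₁ → ν M ⇛ N₂ → Joinable N₁ N₂

⇛-diamond pvar pvar = _ , pvar , pvar
⇛-diamond (pƛ a) (pƛ b) with ⇛-diamond a b
... | P , x , y = ƛ P , pƛ x , pƛ y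
⇛-diamond (p· a b) (p· c d) with ⇛-diamond a c | ⇛-diamond b d
... | P , x , y | Q , z , w = P · Q , p· x z , p· y w
⇛-diamond (p· (pƛ a) b) (pβƛ c d) with ⇛-diamond a c | ⇛-diamond b d
... | P , x , y | Q , z , w = P [ Q ]V , pβƛ x z , ⇛-[]V y w
⇛-diamond (pβƛ a b) (p· (pƛ c) d) with ⇛-diamond a c | ⇛-diamond b d
... | P , x , y | Q , z , w = P [ Q ]V , ⇛-[]V x z , pβƛ y w
⇛-diamond (pβƛ a b) (pβƛ c d) with ⇛-diamond a c | ⇛-diamond b d
... | P , x , y | Q , z , w = P [ Q ]V , ⇛-[]V x z , ⇛-[]V y w
⇛-diamond (pΛ a) (pΛ b) with ⇛-diamond a b
... | P , x , y = Λ P , pΛ x , pΛ y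
⇛-diamond (p·T a) (p·T b) with ⇛-diamond a b
... | P , x , y = P ·T _ , p·T x , p·T y
⇛-diamond (p·T (pΛ a)) (pβΛ {A = A} b) with ⇛-diamond a b
... | P , x , y = P [ A ]TM , pβΛ x , ⇛-[]TM A y
⇛-diamond (pβΛ {A = A} a) (p·T (pΛ b)) with ⇛-diamond a b
... | P , x , y = P [ A ]TM , ⇛-[]TM A x , pβΛ y
⇛-diamond (pβΛ {A = A} a) (pβΛ b) with ⇛-diamond a b
... | P , x , y = P [ A ]TM , ⇛-[]TM A x , ⇛-[]TM A y
⇛-diamond p⋆ p⋆ = ⋆ , p⋆ , p⋆
⇛-diamond (p▷ a b) (p▷ c d) with ⇛-diamond a c | ⇛-diamond b d
... | P , x , y | Q , z , w = (P ▷ Q) , p▷ x z , p▷ y w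
⇛-diamond (p▷ p⋆ b) (p⋆▷ d) with ⇛-diamond b d
... | Q , z , w = Q , p⋆▷ z , w
⇛-diamond (p⋆▷ b) (p▷ p⋆ d) with ⇛-diamond b d
... | Q , z , w = Q , z , p⋆▷ w
⇛-diamond (p⋆▷ b) (p⋆▷ d) = ⇛-diamond b d
⇛-diamond pgen   pgen   = _ , pgen , pgen
⇛-diamond pgen   pgen-⇒ = _ , pgen-⇒ , ⇛-refl _
⇛-diamond pgen   pgen-∀ = _ , pgen-∀ , ⇛-refl _
⇛-diamond pgen-⇒ pgen   = _ , ⇛-refl _ , pgen-⇒
⇛-diamond pgen-⇒ pgen-⇒ = _ , ⇛-refl _ , ⇛-refl _
⇛-diamond pgen-∀ pgen   = _ , ⇛-refl _ , pgen-∀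
⇛-diamond pgen-∀ pgen-∀ = _ , ⇛-refl _ , ⇛-refl _
⇛-diamond a@(pver _)   b = ⇛-diamond-ver a b
⇛-diamond a@pver-ev    b = ⇛-diamond-ver a b
⇛-diamond a@(pver-⇒ _) b = ⇛-diamond-ver a b
⇛-diamond a@(pver-∀ _) b = ⇛-diamond-ver a b
⇛-diamond a@(pν _)      b = ⇛-diamond-ν a b
⇛-diamond a@(pν-drop _) b = ⇛-diamond-ν a b

⇛-diamond-ver (pver a) (pver b) with ⇛-diamond a b
... | P , x , y = ver _ P , pver x , pver y
⇛-diamond-ver (pver pgen) pver-ev = ⋆ , pver-ev , p⋆
⇛-diamond-ver pver-ev (pver pgen) = ⋆ , p⋆ , pver-ev
⇛-diamond-ver pver-ev pver-ev = ⋆ , p⋆ , p⋆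
⇛-diamond-ver (pver a) (pver-⇒ {A = A} b) with ⇛-diamond a b
... | P , x , y = ver _ (P · gen A) , pver-⇒ x , pver (p· y pgen)
⇛-diamond-ver (pver-⇒ {A = A} a) (pver b) with ⇛-diamond a b
... | P , x , y = ver _ (P · gen A) , pver (p· x pgen) , pver-⇒ y
⇛-diamond-ver (pver-⇒ {A = A} a) (pver-⇒ b) with ⇛-diamond a b
... | P , x , y = ver _ (P · gen A) , pver (p· x pgen) , pver (p· y pgen)
⇛-diamond-ver (pver a) (pver-∀ {A = A} b) with ⇛-diamond a b
... | P , x , y =
  ν (ver (openEv A) (renEM suc P ·T ev zero)) , pver-∀ x , pν (pver (p·T (⇛-renEM suc y)))
⇛-diamond-ver (pver-∀ {A = A} a) (pver b) with ⇛-diamond a b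
... | P , x , y =
  ν (ver (openEv A) (renEM suc P ·T ev zero)) , pν (pver (p·T (⇛-renEM suc x))) , pver-∀ y
⇛-diamond-ver (pver-∀ {A = A} a) (pver-∀ b) with ⇛-diamond a b
... | P , x , y =
  ν (ver (openEv A) (renEM suc P ·T ev zero)) , pν (pver (p·T (⇛-renEM suc x))) ,
  pν (pver (p·T (⇛-renEM suc y)))

⇛-diamond-ν (pν a) (pν b) with ⇛-diamond a b
... | P , x , y = ν P , pν x , pν y
⇛-diamond-ν (pν a) (pν-drop b) with ⇛-diamond a b
... | P , x , y with renEM-⇛-inv suc-injective y
... | Q , y′ , refl = Q , pν-drop x , y′
⇛-diamond-ν (pν-drop a) (pν b) with ⇛-diamond a b
... | P , x , y with renEM-⇛-inv suc-injective x
... | Q , x′ , refl = Q , x′ , pν-drop y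
⇛-diamond-ν (pν-drop a) (pν-drop b) with ⇛-diamond a b
... | P , x , y with renEM-⇛-inv suc-injective x | renEM-⇛-inv suc-injective y
... | Q , x′ , refl | Q′ , y′ , eq with renEM-suc-injective eq
... | refl = Q , x′ , y′

infix 4 _⇛*_

_⇛*_ : Tm → Tm → Set
_⇛*_ = Star _⇛_

⇛-strip : M ⇛ N₁ → M ⇛* N₂ → Σ Tm λ P → N₁ ⇛* P × N₂ ⇛ P
⇛-strip a ε = _ , ε , a
⇛-strip a (b ◅ bs) with ⇛-diamond a b
... | P , x , y with ⇛-strip y bs
... | Q , z , w = Q , x ◅ z , w

⇛*-confluent : M ⇛* N₁ → M ⇛* N₂ → Σ Tm λ P → N₁ ⇛* P × N₂ ⇛* P
⇛*-confluent ε bs = _ , bs , ε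
⇛*-confluent (a ◅ as) bs with ⇛-strip a bs
... | P , x , y with ⇛*-confluent as x
... | Q , z , w = Q , z , y ◅ w

⋆-⇛* : ⋆ ⇛* M → M ≡ ⋆
⋆-⇛* ε         = refl
⋆-⇛* (p⋆ ◅ as) = ⋆-⇛* as

-- By confluence, since ⋆ is normal.
↠⋆-stable : X ↠ ⋆ → X ↠ Y → Y ↠ ⋆
↠⋆-stable r s with ⇛*-confluent (gmap id ⟶⇒⇛ r) (gmap id ⟶⇒⇛ s)
... | P , x , y with ⋆-⇛* x
... | refl = kleisliStar id ⇛⇒↠ y

↠-renEM : ∀ ρ → M ↠ N → renEM ρ M ↠ renEM ρ N
↠-renEM ρ = kleisliStar (renEM ρ) (⇛⇒↠ ∘ ⇛-renEM ρ ∘ ⟶⇒⇛)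

RenTm-↠⋆ : Injective _≡_ _≡_ ρ → RenTm ρ M X → X ↠ ⋆ → M ↠ ⋆
RenTm-↠⋆ inj ⋆ʳ ε = ε
RenTm-↠⋆ {ρ = ρ} inj m (s ◅ r) with ⇛-unrename inj m (⟶⇒⇛ s)
... | M′ , d , refl = ⇛⇒↠ d ◅◅ RenTm-↠⋆ inj (RenTm-renEM ρ M′) r

-- Metaterms that never reach ⋆

-- Rigid M: no reduct of M has a redex at its head, hence ver A M never reaches ⋆.
-- RigidFun M (RigidTFun M) says that M · N (M ·T A) is rigid.
data Rigid     : Tm → Set
data RigidFun  : Tm → Set
data RigidTFun : Tm → Set

data Rigid where
  var-rigid    : Rigid (var n)
  gen-tv-rigid : Rigid (gen (tv n))
  app          : RigidFun M → Rigid (M · N)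
  tapp         : RigidTFun M → Rigid (M ·T A)

data RigidFun where
  rigid   : Rigid M → RigidFun M
  Λ-rigid : RigidFun (Λ M)
  gen-ev  : RigidFun (gen (ev n))
  gen-∀   : RigidFun (gen (∀' A))

data RigidTFun where
  rigid   : Rigid M → RigidTFun M
  ƛ-rigid : RigidTFun (ƛ M)
  gen-ev  : RigidTFun (gen (ev n))
  gen-⇒   : RigidTFun (gen (A ⇒ B))

Rigid-step     : Rigid M → M ⟶ M′ → Rigid M′
RigidFun-step  : RigidFun M → M ⟶ M′ → RigidFun M′
RigidTFun-step : RigidTFun M → M ⟶ M′ → RigidTFun M′

Rigid-step var-rigid ()
Rigid-step gen-tv-rigid ()
Rigid-step (app (rigid ())) β-ƛ
Rigid-step (app f) (ξ-·₁ s) = app (RigidFun-step f s)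
Rigid-step (app f) (ξ-·₂ s) = app f
Rigid-step (tapp (rigid ())) β-Λ
Rigid-step (tapp f) (ξ-·T s) = tapp (RigidTFun-step f s)

RigidFun-step (rigid r) s     = rigid (Rigid-step r s)
RigidFun-step Λ-rigid (ξ-Λ s) = Λ-rigid
RigidFun-step gen-∀ r-gen-∀   = Λ-rigid

RigidTFun-step (rigid r) s     = rigid (Rigid-step r s)
RigidTFun-step ƛ-rigid (ξ-ƛ s) = ƛ-rigid
RigidTFun-step gen-⇒ r-gen-⇒   = ƛ-rigid

Rigid-rename     : RenTm ρ M X → Rigid M → Rigid X
RigidFun-rename  : RenTm ρ M X → RigidFun M → RigidFun X
RigidTFun-rename : RenTm ρ M X → RigidTFun M → RigidTFun X

Rigid-rename varʳ var-rigid            = var-rigid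
Rigid-rename (genʳ tvʳ) gen-tv-rigid   = gen-tv-rigid
Rigid-rename (m ·ʳ _) (app f)          = app (RigidFun-rename m f)
Rigid-rename (m ·Tʳ _) (tapp f)        = tapp (RigidTFun-rename m f)

RigidFun-rename m (rigid r)            = rigid (Rigid-rename m r)
RigidFun-rename (Λʳ _) Λ-rigid         = Λ-rigid
RigidFun-rename (genʳ (evʳ _)) gen-ev  = gen-ev
RigidFun-rename (genʳ (∀ʳ _)) gen-∀    = gen-∀

RigidTFun-rename m (rigid r)           = rigid (Rigid-rename m r)
RigidTFun-rename (ƛʳ _) ƛ-rigid        = ƛ-rigid
RigidTFun-rename (genʳ (evʳ _)) gen-ev = gen-ev
RigidTFun-rename (genʳ (_ ⇒ʳ _)) gen-⇒ = gen-⇒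

Rigid-unrename     : RenTm ρ M X → Rigid X → Rigid M
RigidFun-unrename  : RenTm ρ M X → RigidFun X → RigidFun M
RigidTFun-unrename : RenTm ρ M X → RigidTFun X → RigidTFun M

Rigid-unrename varʳ var-rigid          = var-rigid
Rigid-unrename (genʳ tvʳ) gen-tv-rigid = gen-tv-rigid
Rigid-unrename (m ·ʳ _) (app f)        = app (RigidFun-unrename m f)
Rigid-unrename (m ·Tʳ _) (tapp f)      = tapp (RigidTFun-unrename m f)

RigidFun-unrename m (rigid r)           = rigid (Rigid-unrename m r)
RigidFun-unrename (Λʳ _) Λ-rigid        = Λ-rigid
RigidFun-unrename (genʳ (evʳ _)) gen-ev = gen-ev
RigidFun-unrename (genʳ (∀ʳ _)) gen-∀   = gen-∀

RigidTFun-unrename m (rigid r)           = rigid (Rigid-unrename m r)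
RigidTFun-unrename (ƛʳ _) ƛ-rigid        = ƛ-rigid
RigidTFun-unrename (genʳ (evʳ _)) gen-ev = gen-ev
RigidTFun-unrename (genʳ (_ ⇒ʳ _)) gen-⇒ = gen-⇒

data Stuck : Tm → Set where
  under-ν   : Stuck X → Stuck (ν X)
  ver-tv    : Stuck (ver (tv n) M)
  ver-rigid : Rigid M → Stuck (ver A M)

Stuck-unrename : RenTm ρ M X → Stuck X → Stuck M
Stuck-unrename (νʳ m) (under-ν s)        = under-ν (Stuck-unrename m s)
Stuck-unrename (verʳ tvʳ _) ver-tv       = ver-tv
Stuck-unrename (verʳ _ m) (ver-rigid r)  = ver-rigid (Rigid-unrename m r)

Stuck-step : Stuck X → X ⟶ X′ → Stuck X′
Stuck-step (under-ν s) (r-ν {M})   = Stuck-unrename (RenTm-renEM suc M) s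
Stuck-step (under-ν s) (ξ-ν t)     = under-ν (Stuck-step s t)
Stuck-step ver-tv (ξ-ver t)        = ver-tv
Stuck-step (ver-rigid ()) r-ver-ev
Stuck-step (ver-rigid r) r-ver-⇒   = ver-rigid (app (rigid r))
Stuck-step (ver-rigid {M} r) r-ver-∀ =
  under-ν (ver-rigid (tapp (rigid (Rigid-rename (RenTm-renEM suc M) r))))
Stuck-step (ver-rigid r) (ξ-ver t) = ver-rigid (Rigid-step r t)

Stuck-↛⋆ : Stuck X → ¬ (X ↠ ⋆)
Stuck-↛⋆ () ε
Stuck-↛⋆ s (t ◅ r) = Stuck-↛⋆ (Stuck-step s t) r

ver-ev-↠⋆ : ver (ev n) X ↠ ⋆ → X ↠ gen (ev n)
ver-ev-↠⋆ (r-ver-ev ◅ r) = ε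
ver-ev-↠⋆ (ξ-ver s ◅ r)  = s ◅ ver-ev-↠⋆ r

ν-↠⋆ : ν X ↠ ⋆ → X ↠ ⋆
ν-↠⋆ (r-ν ◅ r)   = ↠-renEM suc r
ν-↠⋆ (ξ-ν s ◅ r) = s ◅ ν-↠⋆ r

ƛ-↛-gen : ¬ (ƛ X ↠ gen D)
ƛ-↛-gen (ξ-ƛ s ◅ r) = ƛ-↛-gen r

Λ-↛-gen : ¬ (Λ X ↠ gen D)
Λ-↛-gen (ξ-Λ s ◅ r) = Λ-↛-gen r

gen-↠-gen : gen C ↠ gen D → C ≡ D
gen-↠-gen ε              = refl
gen-↠-gen (r-gen-⇒ ◅ r) = ⊥-elim (ƛ-↛-gen r)
gen-↠-gen (r-gen-∀ ◅ r) = ⊥-elim (Λ-↛-gen r)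

data Elim : Set where
  arg  : Tm → Elim
  targ : Ty → Elim

spine : Tm → List Elim → Tm
spine M []            = M
spine M (arg N ∷ es)  = spine (M · N) es
spine M (targ A ∷ es) = spine (M ·T A) es

Rigid-spine : ∀ es → Rigid M → Rigid (spine M es)
Rigid-spine []            r = r
Rigid-spine (arg N ∷ es)  r = Rigid-spine es (app (rigid r))
Rigid-spine (targ A ∷ es) r = Rigid-spine es (tapp (rigid r))

spine-⟶ : ∀ es → M ⟶ M′ → spine M es ⟶ spine M′ es
spine-⟶ []            s = s
spine-⟶ (arg N ∷ es)  s = spine-⟶ es (ξ-·₁ s)
spine-⟶ (targ A ∷ es) s = spine-⟶ es (ξ-·T s)

ver-spine-↠ : ∀ es → M ↠ M′ → ver A (spine M es) ↠ ver A (spine M′ es)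
ver-spine-↠ es = gmap (λ M → ver _ (spine M es)) (ξ-ver ∘ spine-⟶ es)

-- Blocked P X: X is ν𝐚₁…ν𝐚ₖ.ver_A((M ▷ N) e₁ … eₘ) where M reaches ⋆ only if P does.
data SpineBlocked (P : Tm) : Tm → Set where
  head : (M ↠ ⋆ → P ↠ ⋆) → SpineBlocked P (M ▷ N)
  app  : SpineBlocked P M → SpineBlocked P (M · N)
  tapp : SpineBlocked P M → SpineBlocked P (M ·T A)

data Blocked (P : Tm) : Tm → Set where
  under-ν : Blocked P X → Blocked P (ν X)
  at-ver  : SpineBlocked P M → Blocked P (ver A M)

SpineBlocked-spine : ∀ es → SpineBlocked P M → SpineBlocked P (spine M es)
SpineBlocked-spine []            b = b
SpineBlocked-spine (arg N ∷ es)  b = SpineBlocked-spine es (app b)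
SpineBlocked-spine (targ A ∷ es) b = SpineBlocked-spine es (tapp b)

SpineBlocked-rename : Injective _≡_ _≡_ ρ → RenTm ρ M X → SpineBlocked P M → SpineBlocked P X
SpineBlocked-rename inj (m ▷ʳ _) (head h)  = head (h ∘ RenTm-↠⋆ inj m)
SpineBlocked-rename inj (m ·ʳ _) (app b)   = app (SpineBlocked-rename inj m b)
SpineBlocked-rename inj (m ·Tʳ _) (tapp b) = tapp (SpineBlocked-rename inj m b)

SpineBlocked-unrename : RenTm ρ M X → SpineBlocked P X → SpineBlocked P M
SpineBlocked-unrename {ρ = ρ} (m ▷ʳ _) (head h) =
  head (λ r → h (subst (_↠ ⋆) (sym (renEM-RenTm m)) (↠-renEM ρ r)))
SpineBlocked-unrename (m ·ʳ _) (app b)   = app (SpineBlocked-unrename m b)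
SpineBlocked-unrename (m ·Tʳ _) (tapp b) = tapp (SpineBlocked-unrename m b)

Blocked-unrename : RenTm ρ M X → Blocked P X → Blocked P M
Blocked-unrename (νʳ m) (under-ν b)      = under-ν (Blocked-unrename m b)
Blocked-unrename (verʳ _ m) (at-ver b)   = at-ver (SpineBlocked-unrename m b)

SpineBlocked-step : SpineBlocked P M → M ⟶ M′ → SpineBlocked P M′ ⊎ P ↠ ⋆
SpineBlocked-step (head h) r-▷      = inj₂ (h ε)
SpineBlocked-step (head h) (ξ-▷₁ s) = inj₁ (head (h ∘ (s ◅_)))
SpineBlocked-step (head h) (ξ-▷₂ s) = inj₁ (head h)
SpineBlocked-step (app ()) β-ƛ
SpineBlocked-step (app b) (ξ-·₁ s)  = map₁ app (SpineBlocked-step b s)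
SpineBlocked-step (app b) (ξ-·₂ s)  = inj₁ (app b)
SpineBlocked-step (tapp ()) β-Λ
SpineBlocked-step (tapp b) (ξ-·T s) = map₁ tapp (SpineBlocked-step b s)

Blocked-step : Blocked P X → X ⟶ X′ → Blocked P X′ ⊎ P ↠ ⋆
Blocked-step (under-ν b) (r-ν {M})  = inj₁ (Blocked-unrename (RenTm-renEM suc M) b)
Blocked-step (under-ν b) (ξ-ν s)    = map₁ under-ν (Blocked-step b s)
Blocked-step (at-ver ()) r-ver-ev
Blocked-step (at-ver b) r-ver-⇒     = inj₁ (at-ver (app b))
Blocked-step (at-ver {M} b) r-ver-∀ =
  inj₁ (under-ν (at-ver (tapp (SpineBlocked-rename suc-injective (RenTm-renEM suc M) b))))
Blocked-step (at-ver b) (ξ-ver s)   = map₁ at-ver (SpineBlocked-step b s)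

Blocked-↠⋆ : Blocked P X → X ↠ ⋆ → P ↠ ⋆
Blocked-↠⋆ () ε
Blocked-↠⋆ b (s ◅ r) with Blocked-step b s
... | inj₁ b′ = Blocked-↠⋆ b′ r
... | inj₂ p  = p

ver-spine-▷-↠⋆ : ∀ es → ver A (spine (P ▷ Q) es) ↠ ⋆ → P ↠ ⋆
ver-spine-▷-↠⋆ es = Blocked-↠⋆ (at-ver (SpineBlocked-spine es (head id)))

tySize : Ty → ℕ
tySize (tv _)  = 1
tySize (ev _)  = 1
tySize (A ⇒ B) = suc (tySize A + tySize B)
tySize (∀' A)  = suc (tySize A)

tySize-renT : ∀ ρ A → tySize (renT ρ A) ≡ tySize A
tySize-renT ρ (tv n)  = refl
tySize-renT ρ (ev n)  = refl
tySize-renT ρ (A ⇒ B) = cong₂ (λ a b → suc (a + b)) (tySize-renT ρ A) (tySize-renT ρ B)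
tySize-renT ρ (∀' A)  = cong suc (tySize-renT (liftR ρ) A)

tySize-subTy : ∀ {t e} → (∀ n → tySize (t n) ≡ 1) → (∀ n → tySize (e n) ≡ 1) →
               ∀ A → tySize (subTy t e A) ≡ tySize A
tySize-subTy t₁ e₁ (tv n)  = t₁ n
tySize-subTy t₁ e₁ (ev n)  = e₁ n
tySize-subTy t₁ e₁ (A ⇒ B) =
  cong₂ (λ a b → suc (a + b)) (tySize-subTy t₁ e₁ A) (tySize-subTy t₁ e₁ B)
tySize-subTy {t} {e} t₁ e₁ (∀' A) =
  cong suc (tySize-subTy extsT₁ (λ n → trans (tySize-renT suc (e n)) (e₁ n)) A)
  where
  extsT₁ : ∀ n → tySize (extsT t n) ≡ 1
  extsT₁ zero    = refl
  extsT₁ (suc n) = trans (tySize-renT suc (t n)) (t₁ n)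

tySize-openEv : ∀ A → tySize (openEv A) ≡ tySize A
tySize-openEv A =
  trans (cong tySize (openEv-subTy A)) (tySize-subTy (λ { zero → refl ; (suc n) → refl }) ≗-refl A)

-- By induction on sizes, as the ∀ case compares the opened bodies, which are not subterms.
ver-gen-↠⋆ : ∀ {k} A C → tySize A ≤ k → tySize C ≤ k → ver A (gen C) ↠ ⋆ → A ≡ C
ver-gen-↠⋆ (tv _) C _ _ r = ⊥-elim (Stuck-↛⋆ ver-tv r)
ver-gen-↠⋆ (ev _) C _ _ r = sym (gen-↠-gen (ver-ev-↠⋆ r))
ver-gen-↠⋆ (A₁ ⇒ A₂) C (s≤s a) c r with C | c | ↠⋆-stable r (return r-ver-⇒)
... | tv _    | _     | r′ = ⊥-elim (Stuck-↛⋆ (ver-rigid (app (rigid gen-tv-rigid))) r′)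
... | ev _    | _     | r′ = ⊥-elim (Stuck-↛⋆ (ver-rigid (app gen-ev)) r′)
... | ∀' _    | _     | r′ = ⊥-elim (Stuck-↛⋆ (ver-rigid (app gen-∀)) r′)
... | C₁ ⇒ C₂ | s≤s c | r′ = cong₂ _⇒_ (sym C₁≡A₁) A₂≡C₂
  where
  unfolded : ver A₂ (ver C₁ (gen A₁) ▷ gen C₂) ↠ ⋆
  unfolded = ↠⋆-stable r′ (ξ-ver (ξ-·₁ r-gen-⇒) ◅ ξ-ver β-ƛ ◅ ε)
  domain : ver C₁ (gen A₁) ↠ ⋆
  domain = ver-spine-▷-↠⋆ [] unfolded
  C₁≡A₁ : C₁ ≡ A₁
  C₁≡A₁ = ver-gen-↠⋆ C₁ A₁ (≤-trans (m≤m+n _ _) c) (≤-trans (m≤m+n _ _) a) domain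
  codomain : ver A₂ (gen C₂) ↠ ⋆
  codomain = ↠⋆-stable unfolded
    (gmap (λ X → ver A₂ (X ▷ gen C₂)) (ξ-ver ∘ ξ-▷₁) domain ◅◅ return (ξ-ver r-▷))
  A₂≡C₂ : A₂ ≡ C₂
  A₂≡C₂ = ver-gen-↠⋆ A₂ C₂ (≤-trans (m≤n+m _ _) a) (≤-trans (m≤n+m _ _) c) codomain
ver-gen-↠⋆ (∀' A) C (s≤s a) c r with C | c | ↠⋆-stable r (return r-ver-∀)
... | tv _    | _     | r′ = ⊥-elim (Stuck-↛⋆ (under-ν (ver-rigid (tapp (rigid gen-tv-rigid)))) r′)
... | ev _    | _     | r′ = ⊥-elim (Stuck-↛⋆ (under-ν (ver-rigid (tapp gen-ev))) r′)
... | C₁ ⇒ C₂ | _     | r′ = ⊥-elim (Stuck-↛⋆ (under-ν (ver-rigid (tapp gen-⇒))) r′)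
... | ∀' C′   | s≤s c | r′ = cong ∀' (openEv-injective (ver-gen-↠⋆ (openEv A) (openEv C′)
        (subst (_≤ _) (sym (tySize-openEv A)) a) (subst (_≤ _) (sym (tySize-openEv C′)) c) opened))
  where
  opened : ver (openEv A) (gen (openEv C′)) ↠ ⋆
  opened = subst (λ X → ver (openEv A) X ↠ ⋆) (gen-[]TM (renE suc C′) (ev zero))
    (ν-↠⋆ (↠⋆-stable r′ (ξ-ν (ξ-ver (ξ-·T r-gen-∀)) ◅ ξ-ν (ξ-ver β-Λ) ◅ ε)))

lookupEnv-map : ∀ (f : Ty → Ty) Γ n → lookupEnv (map f Γ) n ≡ Maybe.map f (lookupEnv Γ n)
lookupEnv-map f []      n       = refl
lookupEnv-map f (A ∷ Γ) zero    = refl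
lookupEnv-map f (A ∷ Γ) (suc n) = lookupEnv-map f Γ n

⊢-subTy : ∀ t e → Δ ⊢ M ∶ T → map (subTy t e) Δ ⊢ subTm var t e M ∶ subTy t e T
⊢-subTy {Δ} t e (⊢var {n = n} eq) =
  ⊢var (trans (lookupEnv-map (subTy t e) Δ n) (cong (Maybe.map _) eq))
⊢-subTy t e (⊢ƛ {M = M} d) =
  ⊢ƛ (subst (λ X → _ ⊢ X ∶ _) (subTm-cong (sym ∘ extsV-var) ≗-refl ≗-refl M) (⊢-subTy t e d))
⊢-subTy t e (⊢· d d′) = ⊢· (⊢-subTy t e d) (⊢-subTy t e d′)
⊢-subTy {Δ} t e (⊢Λ d) =
  ⊢Λ (subst (λ Δ′ → Δ′ ⊢ _ ∶ _) weakened (⊢-subTy (extsT t) (renT suc ∘ e) d))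
  where
  weakened : map (subTy (extsT t) (renT suc ∘ e)) (map (renT suc) Δ)
             ≡ map (renT suc) (map (subTy t e) Δ)
  weakened = trans (sym (map-∘ Δ)) (trans (map-cong (subTy-weakenT t e) Δ) (map-∘ Δ))
⊢-subTy t e (⊢·T {A = A} B d) =
  subst (_ ⊢ _ ∶_) (sym (subTy-[]T t e A B)) (⊢·T (subTy t e B) (⊢-subTy t e d))

-- Substituting tv 0 for the eigenvariable 0 turns a derivation about 𝐚 into one under Λ.
⊢-closeEv : map (renE suc) Γ ⊢ openEvTm M ∶ openEv C → map (renT suc) Γ ⊢ M ∶ C
⊢-closeEv {Γ} {M} {C} d = subst₂ (λ Δ X → Δ ⊢ X ∶ C) closed-env (closeSub-openEvTm M)
  (subst (_ ⊢ _ ∶_) (closeSub-openEv C) (⊢-subTy (tv ∘ suc) closeSub d))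
  where
  closed-env : map (subTy (tv ∘ suc) closeSub) (map (renE suc) Γ) ≡ map (renT suc) Γ
  closed-env = trans (sym (map-∘ Γ)) (map-cong closeSub-renE Γ)

-- A λ applied to a type or a Λ applied to a term is not a β-redex, so such ill-formed
-- applications count as neutral here.
data Nf : Tm → Set
data Ne : Tm → Set

data Nf where
  ƛ-nf : Nf M → Nf (ƛ M)
  Λ-nf : Nf M → Nf (Λ M)
  ne   : Ne M → Nf M

data Ne where
  var-ne  : Ne (var n)
  app-ne  : Ne M → Nf N → Ne (M · N)
  tapp-ne : Ne M → Ne (M ·T A)
  ƛ·T-ne  : Nf M → Ne (ƛ M ·T A)
  Λ·-ne   : Nf M → Nf N → Ne (Λ M · N)

β-Normal⇒Nf : Pure M → β-Normal M → Nf M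
β-Normal⇒Nf p-var       normal = ne var-ne
β-Normal⇒Nf (p-ƛ p)     normal = ƛ-nf (β-Normal⇒Nf p (normal ∘ ξ-ƛ))
β-Normal⇒Nf (p-Λ p)     normal = Λ-nf (β-Normal⇒Nf p (normal ∘ ξ-Λ))
β-Normal⇒Nf (p-· p q)   normal with β-Normal⇒Nf p (normal ∘ ξ-·₁) | β-Normal⇒Nf q (normal ∘ ξ-·₂)
... | ƛ-nf _  | _  = ⊥-elim (normal β-ƛ)
... | Λ-nf m  | nq = ne (Λ·-ne m nq)
... | ne m    | nq = ne (app-ne m nq)
β-Normal⇒Nf (p-·T p)    normal with β-Normal⇒Nf p (normal ∘ ξ-·T)
... | ƛ-nf m = ne (ƛ·T-ne m)
... | Λ-nf _ = ⊥-elim (normal β-Λ)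
... | ne m   = ne (tapp-ne m)

Nf-renEM : Nf M → Nf (renEM ρ M)
Ne-renEM : Ne M → Ne (renEM ρ M)
Nf-renEM (ƛ-nf m)     = ƛ-nf (Nf-renEM m)
Nf-renEM (Λ-nf m)     = Λ-nf (Nf-renEM m)
Nf-renEM (ne m)       = ne (Ne-renEM m)
Ne-renEM var-ne       = var-ne
Ne-renEM (app-ne m n) = app-ne (Ne-renEM m) (Nf-renEM n)
Ne-renEM (tapp-ne m)  = tapp-ne (Ne-renEM m)
Ne-renEM (ƛ·T-ne m)   = ƛ·T-ne (Nf-renEM m)
Ne-renEM (Λ·-ne m n)  = Λ·-ne (Nf-renEM m) (Nf-renEM n)

Nf-substTM : ∀ {σ} → Nf M → Nf (substTM σ M)
Ne-substTM : ∀ {σ} → Ne M → Ne (substTM σ M)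
Nf-substTM (ƛ-nf m)     = ƛ-nf (Nf-substTM m)
Nf-substTM (Λ-nf m)     = Λ-nf (Nf-substTM m)
Nf-substTM (ne m)       = ne (Ne-substTM m)
Ne-substTM var-ne       = var-ne
Ne-substTM (app-ne m n) = app-ne (Ne-substTM m) (Nf-substTM n)
Ne-substTM (tapp-ne m)  = tapp-ne (Ne-substTM m)
Ne-substTM (ƛ·T-ne m)   = ƛ·T-ne (Nf-substTM m)
Ne-substTM (Λ·-ne m n)  = Λ·-ne (Nf-substTM m) (Nf-substTM n)

tmSize : Tm → ℕ
tmSize (var _)   = 1
tmSize (ƛ M)     = suc (tmSize M)
tmSize (M · N)   = suc (tmSize M + tmSize N)
tmSize (Λ M)     = suc (tmSize M)
tmSize (M ·T A)  = suc (tmSize M)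
tmSize ⋆         = 1
tmSize (M ▷ N)   = suc (tmSize M + tmSize N)
tmSize (gen A)   = 1
tmSize (ver A M) = suc (tmSize M)
tmSize (ν M)     = suc (tmSize M)

tmSize-renEM : ∀ ρ M → tmSize (renEM ρ M) ≡ tmSize M
tmSize-renEM ρ (var n)   = refl
tmSize-renEM ρ (ƛ M)     = cong suc (tmSize-renEM ρ M)
tmSize-renEM ρ (M · N)   = cong₂ (λ a b → suc (a + b)) (tmSize-renEM ρ M) (tmSize-renEM ρ N)
tmSize-renEM ρ (Λ M)     = cong suc (tmSize-renEM ρ M)
tmSize-renEM ρ (M ·T A)  = cong suc (tmSize-renEM ρ M)
tmSize-renEM ρ ⋆         = refl
tmSize-renEM ρ (M ▷ N)   = cong₂ (λ a b → suc (a + b)) (tmSize-renEM ρ M) (tmSize-renEM ρ N)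
tmSize-renEM ρ (gen A)   = refl
tmSize-renEM ρ (ver A M) = cong suc (tmSize-renEM ρ M)
tmSize-renEM ρ (ν M)     = cong suc (tmSize-renEM (liftR ρ) M)

tmSize-substTM : ∀ σ M → tmSize (substTM σ M) ≡ tmSize M
tmSize-substTM σ (var n)   = refl
tmSize-substTM σ (ƛ M)     = cong suc (tmSize-substTM σ M)
tmSize-substTM σ (M · N)   = cong₂ (λ a b → suc (a + b)) (tmSize-substTM σ M) (tmSize-substTM σ N)
tmSize-substTM σ (Λ M)     = cong suc (tmSize-substTM (extsT σ) M)
tmSize-substTM σ (M ·T A)  = cong suc (tmSize-substTM σ M)
tmSize-substTM σ ⋆         = refl
tmSize-substTM σ (M ▷ N)   = cong₂ (λ a b → suc (a + b)) (tmSize-substTM σ M) (tmSize-substTM σ N)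
tmSize-substTM σ (gen A)   = refl
tmSize-substTM σ (ver A M) = cong suc (tmSize-substTM σ M)
tmSize-substTM σ (ν M)     = cong suc (tmSize-substTM _ M)

tmSize-openEvTm : ∀ M → tmSize (openEvTm M) ≡ tmSize M
tmSize-openEvTm M = trans (tmSize-substTM _ (renEM suc M)) (tmSize-renEM suc M)

Pure-renV : Pure M → Pure (renV ρ M)
Pure-renV p-var      = p-var
Pure-renV (p-ƛ p)    = p-ƛ (Pure-renV p)
Pure-renV (p-· p q)  = p-· (Pure-renV p) (Pure-renV q)
Pure-renV (p-Λ p)    = p-Λ (Pure-renV p)
Pure-renV (p-·T p)   = p-·T (Pure-renV p)

Pure-renTM : Pure M → Pure (renTM ρ M)
Pure-renTM p-var     = p-var
Pure-renTM (p-ƛ p)   = p-ƛ (Pure-renTM p)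
Pure-renTM (p-· p q) = p-· (Pure-renTM p) (Pure-renTM q)
Pure-renTM (p-Λ p)   = p-Λ (Pure-renTM p)
Pure-renTM (p-·T p)  = p-·T (Pure-renTM p)

Pure-substV : (∀ n → Pure (σ n)) → Pure M → Pure (substV σ M)
Pure-substV σ-pure p-var      = σ-pure _
Pure-substV σ-pure (p-ƛ p)    = p-ƛ (Pure-substV (λ { zero → p-var ; (suc n) → Pure-renV (σ-pure n) }) p)
Pure-substV σ-pure (p-· p q)  = p-· (Pure-substV σ-pure p) (Pure-substV σ-pure q)
Pure-substV σ-pure (p-Λ p)    = p-Λ (Pure-substV (Pure-renTM ∘ σ-pure) p)
Pure-substV σ-pure (p-·T p)   = p-·T (Pure-substV σ-pure p)

Pure-substTM : ∀ {σ} → Pure M → Pure (substTM σ M)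
Pure-substTM p-var     = p-var
Pure-substTM (p-ƛ p)   = p-ƛ (Pure-substTM p)
Pure-substTM (p-· p q) = p-· (Pure-substTM p) (Pure-substTM q)
Pure-substTM (p-Λ p)   = p-Λ (Pure-substTM p)
Pure-substTM (p-·T p)  = p-·T (Pure-substTM p)

Pure-⟶β : Pure M → M ⟶β N → Pure N
Pure-⟶β (p-· (p-ƛ p) q) β-ƛ = Pure-substV (λ { zero → q ; (suc n) → p-var }) p
Pure-⟶β (p-·T (p-Λ p)) β-Λ  = Pure-substTM p
Pure-⟶β (p-ƛ p)   (ξ-ƛ s)   = p-ƛ (Pure-⟶β p s)
Pure-⟶β (p-· p q) (ξ-·₁ s)  = p-· (Pure-⟶β p s) q
Pure-⟶β (p-· p q) (ξ-·₂ s)  = p-· p (Pure-⟶β q s)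
Pure-⟶β (p-Λ p)   (ξ-Λ s)   = p-Λ (Pure-⟶β p s)
Pure-⟶β (p-·T p)  (ξ-·T s)  = p-·T (Pure-⟶β p s)

Pure-↠β : Pure M → M ↠β N → Pure N
Pure-↠β p ε       = p
Pure-↠β p (s ◅ r) = Pure-↠β (Pure-⟶β p s) r

⟶β⇒⟶ : M ⟶β N → M ⟶ N
⟶β⇒⟶ β-ƛ      = β-ƛ
⟶β⇒⟶ β-Λ      = β-Λ
⟶β⇒⟶ (ξ-ƛ s)  = ξ-ƛ (⟶β⇒⟶ s)
⟶β⇒⟶ (ξ-·₁ s) = ξ-·₁ (⟶β⇒⟶ s)
⟶β⇒⟶ (ξ-·₂ s) = ξ-·₂ (⟶β⇒⟶ s)
⟶β⇒⟶ (ξ-Λ s)  = ξ-Λ (⟶β⇒⟶ s)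
⟶β⇒⟶ (ξ-·T s) = ξ-·T (⟶β⇒⟶ s)

substV-↠ : ∀ σ → M ↠ N → substV σ M ↠ substV σ N
substV-↠ σ = kleisliStar (substV σ) step
  where
  step : M ⟶ N → substV σ M ↠ substV σ N
  step {M} {N} s = ⇛⇒↠ (subst₂ _⇛_ (sym (substV-subTm σ M)) (sym (substV-subTm σ N))
                                  (⇛-subTm {ρ = id} ≗-refl (⟶⇒⇛ s)))

-- GenSubst Γ φ: φ sends each x : A of Γ to gen_A and every other variable to a variable,
-- as M ↦ M ^ Γ does; the invariant survives going under λ and Λ.
GenEntry : Maybe Ty → Tm → Set
GenEntry (just A) X = X ≡ gen A
GenEntry nothing  X = Σ ℕ λ k → X ≡ var k

GenSubst : Env → (ℕ → Tm) → Set
GenSubst Γ φ = ∀ n → GenEntry (lookupEnv Γ n) (φ n)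

GenSubst-^ : ∀ Γ → GenSubst Γ (λ n → maybe gen (var n) (lookupEnv Γ n))
GenSubst-^ Γ n with lookupEnv Γ n
... | just A  = refl
... | nothing = n , refl

GenSubst-∷ : GenSubst Γ φ → GenSubst (B ∷ Γ) (cons (gen B) φ)
GenSubst-∷ gs zero    = refl
GenSubst-∷ gs (suc n) = gs n

GenSubst-renEM : GenSubst Γ φ → GenSubst (map (renE suc) Γ) (renEM suc ∘ φ)
GenSubst-renEM {Γ} {φ} gs n =
  subst (λ m → GenEntry m (renEM suc (φ n))) (sym (lookupEnv-map (renE suc) Γ n))
        (renamed (lookupEnv Γ n) (gs n))
  where
  renamed : ∀ m {X} → GenEntry m X → GenEntry (Maybe.map (renE suc) m) (renEM suc X)
  renamed (just A) refl    = refl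
  renamed nothing (k , refl) = k , refl

-- The size bound is fuel: the Λ case recurses on openEvTm M, which is not a subterm of Λ M.
check : tmSize M ≤ k → Nf M → ∀ Γ {φ} A → GenSubst Γ φ →
        ver A (substV φ M) ↠ ⋆ → Γ ⊢ M ∶ A
infer : tmSize M ≤ k → Ne M → ∀ Γ {φ} → GenSubst Γ φ → ∀ es A →
        ver A (spine (substV φ M) es) ↠ ⋆ →
        Σ Ty λ C → Γ ⊢ M ∶ C × ver A (spine (gen C) es) ↠ ⋆

check _ (ƛ-nf _) Γ (tv _) gs r = ⊥-elim (Stuck-↛⋆ ver-tv r)
check _ (ƛ-nf _) Γ (ev _) gs r = ⊥-elim (ƛ-↛-gen (ver-ev-↠⋆ r))
check _ (ƛ-nf _) Γ (∀' _) gs r =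
  ⊥-elim (Stuck-↛⋆ (under-ν (ver-rigid (tapp ƛ-rigid))) (↠⋆-stable r (return r-ver-∀)))
check {ƛ M} (s≤s h) (ƛ-nf m) Γ {φ} (B ⇒ C) gs r = ⊢ƛ (check h m (B ∷ Γ) C (GenSubst-∷ gs) body)
  where
  body : ver C (substV (cons (gen B) φ) M) ↠ ⋆
  body = subst (λ X → ver C X ↠ ⋆) (substV-extsV-[]V φ (gen B) M)
               (↠⋆-stable r (r-ver-⇒ ◅ ξ-ver β-ƛ ◅ ε))
check _ (Λ-nf _) Γ (tv _) gs r = ⊥-elim (Stuck-↛⋆ ver-tv r)
check _ (Λ-nf _) Γ (ev _) gs r = ⊥-elim (Λ-↛-gen (ver-ev-↠⋆ r))
check _ (Λ-nf _) Γ (_ ⇒ _) gs r =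
  ⊥-elim (Stuck-↛⋆ (ver-rigid (app Λ-rigid)) (↠⋆-stable r (return r-ver-⇒)))
check {Λ M} (s≤s h) (Λ-nf m) Γ {φ} (∀' C) gs r =
  ⊢Λ (⊢-closeEv (check (subst (_≤ _) (sym (tmSize-openEvTm M)) h) (Nf-substTM (Nf-renEM m))
                        (map (renE suc) Γ) (openEv C) (GenSubst-renEM {Γ} gs) opened))
  where
  opened : ver (openEv C) (substV (renEM suc ∘ φ) (openEvTm M)) ↠ ⋆
  opened = subst (λ X → ver (openEv C) X ↠ ⋆) (openEvTm-substV φ M)
                 (ν-↠⋆ (↠⋆-stable r (r-ver-∀ ◅ ξ-ν (ξ-ver β-Λ) ◅ ε)))
check h (ne m) Γ A gs r with infer h m Γ gs [] A r
... | C , ⊢M , r′ = subst (Γ ⊢ _ ∶_) (sym (ver-gen-↠⋆ A C (m≤m+n _ _) (m≤n+m _ _) r′)) ⊢M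

infer {var x} _ var-ne Γ gs es A r with lookupEnv Γ x in eq | gs x
... | just C  | φx≡gen     = C , ⊢var eq , subst (λ X → ver A (spine X es) ↠ ⋆) φx≡gen r
... | nothing | k , φx≡var = ⊥-elim (Stuck-↛⋆ (ver-rigid (Rigid-spine es var-rigid))
                                              (subst (λ X → ver A (spine X es) ↠ ⋆) φx≡var r))
infer {M · N} (s≤s h) (app-ne m n) Γ {φ} gs es A r
  with infer (m+n≤o⇒m≤o (tmSize M) h) m Γ gs (arg (substV φ N) ∷ es) A r
... | tv _ , _ , r′ = ⊥-elim (Stuck-↛⋆ (ver-rigid (Rigid-spine es (app (rigid gen-tv-rigid)))) r′)
... | ev _ , _ , r′ = ⊥-elim (Stuck-↛⋆ (ver-rigid (Rigid-spine es (app gen-ev))) r′)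
... | ∀' _ , _ , r′ = ⊥-elim (Stuck-↛⋆ (ver-rigid (Rigid-spine es (app gen-∀))) r′)
... | C₁ ⇒ C₂ , ⊢M , r′ = C₂ , ⊢· ⊢M ⊢N , codomain
  where
  unfolded : ver A (spine (ver C₁ (substV φ N) ▷ gen C₂) es) ↠ ⋆
  unfolded = ↠⋆-stable r′ (ver-spine-↠ es (ξ-·₁ r-gen-⇒ ◅ β-ƛ ◅ ε))
  domain : ver C₁ (substV φ N) ↠ ⋆
  domain = ver-spine-▷-↠⋆ es unfolded
  ⊢N : Γ ⊢ N ∶ C₁
  ⊢N = check (m+n≤o⇒n≤o (tmSize M) h) n Γ C₁ gs domain
  codomain : ver A (spine (gen C₂) es) ↠ ⋆
  codomain = ↠⋆-stable unfolded (ver-spine-↠ es (gmap (_▷ gen C₂) ξ-▷₁ domain ◅◅ return r-▷))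
infer {M ·T B} (s≤s h) (tapp-ne m) Γ gs es A r with infer h m Γ gs (targ B ∷ es) A r
... | tv _ , _ , r′  = ⊥-elim (Stuck-↛⋆ (ver-rigid (Rigid-spine es (tapp (rigid gen-tv-rigid)))) r′)
... | ev _ , _ , r′  = ⊥-elim (Stuck-↛⋆ (ver-rigid (Rigid-spine es (tapp gen-ev))) r′)
... | _ ⇒ _ , _ , r′ = ⊥-elim (Stuck-↛⋆ (ver-rigid (Rigid-spine es (tapp gen-⇒))) r′)
... | ∀' C , ⊢M , r′ = C [ B ]T , ⊢·T B ⊢M ,
  subst (λ X → ver A (spine X es) ↠ ⋆) (gen-[]TM C B)
        (↠⋆-stable r′ (ver-spine-↠ es (ξ-·T r-gen-∀ ◅ β-Λ ◅ ε)))
infer _ (ƛ·T-ne _) Γ gs es A r = ⊥-elim (Stuck-↛⋆ (ver-rigid (Rigid-spine es (tapp ƛ-rigid))) r)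
infer _ (Λ·-ne _ _) Γ gs es A r = ⊥-elim (Stuck-↛⋆ (ver-rigid (Rigid-spine es (app Λ-rigid))) r)

theorem4p14 : (Γ : Env) (A : Ty) (M : Tm) → Good M → ver A (M ^ Γ) ↠ ⋆ →
              ∀ N → M ↠β N → β-Normal N → Pure N × (Γ ⊢ N ∶ A)
theorem4p14 Γ A M (pure-M , _) r N M↠N normal =
  pure-N , check ≤-refl (β-Normal⇒Nf pure-N normal) Γ A (GenSubst-^ Γ) r′
  where
  pure-N : Pure N
  pure-N = Pure-↠β pure-M M↠N
  r′ : ver A (substV (λ n → maybe gen (var n) (lookupEnv Γ n)) N) ↠ ⋆
  r′ = ↠⋆-stable r (gmap (ver A) ξ-ver (substV-↠ _ (gmap id ⟶β⇒⟶ M↠N)))
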